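{- For every integer $n\ge1$, every $c\in\mathbb{Q}$ and every $w\in\mathfrak{H}$, \[ \partial_n^{(c)}(wx)=\bigl(w\diamond q_n^{(c)}\bigr)x. \]
   Context: Let $\mathfrak{H}=\mathbb{Q}\langle x,y\rangle$ be the noncommutative polynomial algebra in $x,y$, and set $z=x+y$. For $n\ge1$, $\partial_n$ is the $\mathbb{Q}$-linear derivation of $\mathfrak{H}$ with $\partial_n(x)=yz^{n-1}x$ and $\partial_n(y)=-yz^{n-1}x$. Let $H:\mathfrak{H}\to\mathfrak{H}$ be the $\mathbb{Q}$-linear map with $H(w)=\deg(w)\,w$ for every monomial $w$. For $c\in\mathbb{Q}$, $\theta=\theta^{(c)}$ is the unique $\mathbb{Q}$-linear map $\mathfrak{H}\to\mathfrak{H}$ with $\theta(1)=0$, $\theta(x)=xz$, $\theta(y)=yz$ and $\theta(ww')=\theta(w)w'+w\theta(w')+cH(w)\partial_1(w')$ for all $w,w'\in\mathfrak{H}$. Define $\partial_n^{(c)}=\frac{1}{(n-1)!}\mathrm{ad}(\theta)^{n-1}(\partial_1)$, where $\mathrm{ad}(\theta)(D)=\theta\circ D-D\circ\theta$. Let $\tilde\theta=\tilde\theta^{(c)}:\mathfrak{H}\to\mathfrak{H}$ be $\tilde\theta(w)=\theta(w)+cH(w)y$, and $q_n=q_n^{(c)}=\frac{1}{(n-1)!}\tilde\theta^{\,n-1}(y)$. The harmonic product $*$ on $\mathfrak{H}$ is the $\mathbb{Q}$-bilinear product defined recursively by $1*w=w*1=w$, $xw_1*w_2=w_1*xw_2=x(w_1*w_2)$,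 and $yw_1*yw_2=y(w_1*yw_2)+y(yw_1*w_2)+yx(w_1*w_2)$ for $w,w_1,w_2\in\mathfrak{H}$. Let $\phi$ be the algebra automorphism of $\mathfrak{H}$ with $\phi(x)=z$, $\phi(y)=-y$ (an involution). Define $w_1\diamond w_2=\phi(\phi(w_1)*\phi(w_2))$. -}

module Defs where

open import Data.Nat as ℕ using (ℕ; zero; suc; _∸_; _!)
open import Data.Nat.Properties using (_!≢0)
open import Data.Integer using (+_)
open import Data.Rational using (ℚ; 0ℚ; 1ℚ; _+_; _*_; -_; _/_)
open import Data.List using (List; []; _∷_; _++_; map; concatMap; length)
open import Data.Product using (_×_; _,_)
open import Data.Bool using (Bool; true; false)
open import Relation.Binary.PropositionalEquality using (_≡_)

data Letter : Set where
  X Y : Letter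

Word : Set
Word = List Letter

_==L_ : Letter → Letter → Bool
X ==L X = true
Y ==L Y = true
_ ==L _ = false

_==W_ : Word → Word → Bool
[] ==W [] = true
(a ∷ u) ==W (b ∷ v) with a ==L b
... | true  = u ==W v
... | false = false
_ ==W _ = false

-- A polynomial is a finite formal ℚ-linear combination of words.
-- Two polynomials are equal iff all their coefficients agree (_≈_).
Poly : Set
Poly = List (ℚ × Word)

coeff : Poly → Word → ℚ
coeff [] u = 0ℚ
coeff ((a , v) ∷ p) u with v ==W u
... | true  = a + coeff p u
... | false = coeff p u

infix 4 _≈_
_≈_ : Poly → Poly → Set
p ≈ q = ∀ u → coeff p u ≡ coeff q u

0P : Poly
0P = []

mon : Word → Poly
mon w = (1ℚ , w) ∷ []

infixl 6 _⊕_ _⊖_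
_⊕_ : Poly → Poly → Poly
p ⊕ q = p ++ q

infixr 7 _·_
_·_ : ℚ → Poly → Poly
a · p = map (λ { (b , w) → (a * b , w) }) p

_⊖_ : Poly → Poly → Poly
p ⊖ q = p ⊕ (- 1ℚ) · q

lin : (Word → Poly) → Poly → Poly
lin f p = concatMap (λ { (a , w) → a · f w }) p

infixl 7 _⊗_
_⊗_ : Poly → Poly → Poly
p ⊗ q = concatMap (λ { (a , u) → map (λ { (b , v) → (a * b , u ++ v) }) q }) p

x y z : Poly
x = mon (X ∷ [])
y = mon (Y ∷ [])
z = x ⊕ y

pre : Letter → Poly → Poly
pre l p = map (λ { (a , w) → (a , l ∷ w) }) p

fromℕ : ℕ → ℚ
fromℕ n = + n / 1

H : Poly → Poly
H = lin (λ w → fromℕ (length w) · mon w)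

∂₁L : Letter → Poly
∂₁L X = y ⊗ x
∂₁L Y = (- 1ℚ) · (y ⊗ x)

∂₁W : Word → Poly
∂₁W [] = 0P
∂₁W (l ∷ u) = (∂₁L l ⊗ mon u) ⊕ pre l (∂₁W u)

∂₁ : Poly → Poly
∂₁ = lin ∂₁W

-- θ = θ^(c): θ(1)=0, θ(x)=xz, θ(y)=yz,
-- θ(ww') = θ(w)w' + wθ(w') + c H(w) ∂₁(w').
-- On words it is determined by taking w a single letter l (H(l) = l):
-- θ(l u) = θ(l) u + l θ(u) + c l ∂₁(u).

θL : Letter → Poly
θL l = mon (l ∷ []) ⊗ z

θW : ℚ → Word → Poly
θW c [] = 0P
θW c (l ∷ u) = (θL l ⊗ mon u) ⊕ pre l (θW c u) ⊕ c · pre l (∂₁ (mon u))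

θ : ℚ → Poly → Poly
θ c = lin (θW c)

ad : (Poly → Poly) → (Poly → Poly) → (Poly → Poly)
ad T D p = T (D p) ⊖ D (T p)

iter : {A : Set} → ℕ → (A → A) → A → A
iter zero f a = a
iter (suc k) f a = f (iter k f a)

invFact : ℕ → ℚ
invFact k = (+ 1 / (k !)) {{k !≢0}}

∂ : ℚ → ℕ → Poly → Poly
∂ c n p = invFact (n ∸ 1) · iter (n ∸ 1) (ad (θ c)) ∂₁ p

θ̃ : ℚ → Poly → Poly
θ̃ c w = θ c w ⊕ c · (H w ⊗ y)

q : ℚ → ℕ → Poly
q c n = invFact (n ∸ 1) · iter (n ∸ 1) (θ̃ c) y

_*W_ : Word → Word → Poly
[] *W v = mon v
(X ∷ u) *W v = pre X (u *W v)
(Y ∷ u) *W [] = mon (Y ∷ u)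
(Y ∷ u) *W (X ∷ v) = pre X ((Y ∷ u) *W v)
(Y ∷ u) *W (Y ∷ v) =
  pre Y (u *W (Y ∷ v)) ⊕ pre Y ((Y ∷ u) *W v) ⊕ pre Y (pre X (u *W v))

_⋆_ : Poly → Poly → Poly
p ⋆ q' = concatMap (λ { (a , u) → concatMap (λ { (b , v) → (a * b) · (u *W v) }) q' }) p

φL : Letter → Poly
φL X = z
φL Y = (- 1ℚ) · y

φW : Word → Poly
φW [] = mon []
φW (l ∷ u) = φL l ⊗ φW u

φ : Poly → Poly
φ = lin φW

_◇_ : Poly → Poly → Poly
p ◇ q' = φ (φ p ⋆ φ q')

-- Write D k = ad(θ)^k ∂₁ and Q k = θ̃^k y, so that ∂ₙ and qₙ are D (n-1) and Q (n-1) divided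
-- by (n-1)!.  We show D k (w x) = (w ◇ Q k) x by induction on k.  For k = 0 this is
-- w ◇ y = w y + ∂₁ w.  For the step, θ (p x) = θ̃ p x + (p x) z and D k (p z) = (D k p) z give
-- D (k+1) (w x) = (θ̃ (w ◇ Q k) - θ̃ w ◇ Q k) x, so it remains to see that θ̃ is a derivation of ◇.
-- Conjugated by φ, θ̃ becomes the map a₁⋯aₙ ↦ Σᵢ a₁⋯aᵢ σ(aᵢ₊₁⋯aₙ) with σ p = x p - c (p * y).
-- Such a map is a derivation of * as soon as σ commutes with left multiplication by x and
-- σ (p * q) = σ p * q, and the latter holds because (p * q) * y = (p * y) * q.
{-# OPTIONS --safe #-}
module Submission where

open import Defs
open import Data.Nat using (ℕ; _≤_)
open import Data.Rational using (ℚ)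

open import Data.Nat as ℕ using (zero; suc; _∸_)
open import Data.Integer as ℤ using ()
import Data.Integer.Properties as ℤ
open import Data.Fin using (Fin)
open import Data.Fin.Properties using () renaming (_≟_ to _≟ᶠ_)
open import Data.Maybe using (Maybe; just; nothing)
open import Data.Vec as Vec using (Vec; lookup; allFin)
open import Data.Vec.N-ary using (N-ary; _$ⁿ_; curryⁿ; Eq; curryⁿ-cong)
open import Data.Rational using (0ℚ; 1ℚ; _+_; _*_; -_)
open import Data.Rational.Properties
  using (+-*-commutativeRing; *-zeroʳ; *-zeroˡ; +-identityʳ; +-identityˡ; *-identityʳ; *-identityˡ;
         +-assoc; *-assoc; *-distribʳ-+; *-distribˡ-+; normalize-coprime; /-cong)
  renaming (_≟_ to _≟ℚ_)
open import Data.Nat.Coprimality using (1-coprimeTo) renaming (sym to coprime-sym)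
open import Data.List using (List; []; _∷_; _++_; map; concatMap; length)
open import Data.List.Properties using (++-assoc; ++-identityʳ)
open import Data.Bool using (true; false; if_then_else_)
open import Data.Product using (_×_; _,_; proj₁; proj₂)
open import Function using (_∘_)
open import Relation.Binary.PropositionalEquality
  using (_≡_; refl; sym; trans; cong; cong₂; module ≡-Reasoning)
open import Relation.Nullary using (Dec; yes; no; dec⇒maybe)
open import Tactic.RingSolver using (solve-∀)
open import Tactic.RingSolver.Core.AlmostCommutativeRing using (AlmostCommutativeRing; fromCommutativeRing)

ℚ-ring : AlmostCommutativeRing _ _
ℚ-ring = fromCommutativeRing +-*-commutativeRing (λ a → dec⇒maybe (0ℚ ≟ℚ a))

factor-*ˡ : ∀ a b x s → a * b * x + a * s ≡ a * (b * x + s)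
factor-*ˡ = solve-∀ ℚ-ring

eval : (Word → ℚ) → Poly → ℚ
eval h [] = 0ℚ
eval h ((a , w) ∷ p) = a * h w + eval h p

eval-⊕ : ∀ h p q → eval h (p ⊕ q) ≡ eval h p + eval h q
eval-⊕ h [] q = sym (+-identityˡ (eval h q))
eval-⊕ h ((a , w) ∷ p) q =
  trans (cong (a * h w +_) (eval-⊕ h p q)) (sym (+-assoc (a * h w) (eval h p) (eval h q)))

eval-· : ∀ h a p → eval h (a · p) ≡ a * eval h p
eval-· h a [] = sym (*-zeroʳ a)
eval-· h a ((b , w) ∷ p) =
  trans (cong (a * b * h w +_) (eval-· h a p)) (factor-*ˡ a b (h w) (eval h p))

eval-mon : ∀ h w → eval h (mon w) ≡ h w
eval-mon h w = trans (+-identityʳ (1ℚ * h w)) (*-identityˡ (h w))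

eval-pre : ∀ h l p → eval h (pre l p) ≡ eval (h ∘ (l ∷_)) p
eval-pre h l [] = refl
eval-pre h l ((a , w) ∷ p) = cong (a * h (l ∷ w) +_) (eval-pre h l p)

eval-cong : ∀ {g g'} p → (∀ w → g w ≡ g' w) → eval g p ≡ eval g' p
eval-cong [] g≡g' = refl
eval-cong ((a , w) ∷ p) g≡g' = cong₂ (λ s t → a * s + t) (g≡g' w) (eval-cong p g≡g')

eval-+ : ∀ g g' p → eval (λ w → g w + g' w) p ≡ eval g p + eval g' p
eval-+ g g' [] = sym (+-identityʳ 0ℚ)
eval-+ g g' ((a , w) ∷ p) = trans (cong (a * (g w + g' w) +_) (eval-+ g g' p))
  (lemma a (g w) (g' w) (eval g p) (eval g' p))
  where
  lemma : ∀ a x x' s s' → a * (x + x') + (s + s') ≡ a * x + s + (a * x' + s')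
  lemma = solve-∀ ℚ-ring

eval-* : ∀ k g p → eval (λ w → k * g w) p ≡ k * eval g p
eval-* k g [] = sym (*-zeroʳ k)
eval-* k g ((a , w) ∷ p) =
  trans (cong (a * (k * g w) +_) (eval-* k g p)) (lemma k a (g w) (eval g p))
  where
  lemma : ∀ k a x s → a * (k * x) + k * s ≡ k * (a * x + s)
  lemma = solve-∀ ℚ-ring

eval-0 : ∀ p → eval (λ _ → 0ℚ) p ≡ 0ℚ
eval-0 [] = refl
eval-0 ((a , w) ∷ p) = trans (cong (a * 0ℚ +_) (eval-0 p)) (trans (+-identityʳ _) (*-zeroʳ a))

eval-lin : ∀ h f p → eval h (lin f p) ≡ eval (λ w → eval h (f w)) p
eval-lin h f [] = refl
eval-lin h f ((a , w) ∷ p) =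
  trans (eval-⊕ h (a · f w) (lin f p)) (cong₂ _+_ (eval-· h a (f w)) (eval-lin h f p))

eval-⊗ : ∀ h p q → eval h (p ⊗ q) ≡ eval (λ u → eval (λ v → h (u ++ v)) q) p
eval-⊗ h [] q = refl
eval-⊗ h ((a , u) ∷ p) q =
  trans (eval-⊕ h (map _ q) (p ⊗ q)) (cong₂ _+_ (row (λ _ _ → refl) q) (eval-⊗ h p q))
  where
  row : ∀ {f} → (∀ b v → f (b , v) ≡ (a * b , u ++ v)) →
        ∀ q → eval h (map f q) ≡ a * eval (λ v → h (u ++ v)) q
  row f≡ [] = sym (*-zeroʳ a)
  row f≡ ((b , v) ∷ q) rewrite f≡ b v =
    trans (cong (a * b * h (u ++ v) +_) (row f≡ q)) (factor-*ˡ a b (h (u ++ v)) _)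

eval-⋆ : ∀ h p q → eval h (p ⋆ q) ≡ eval (λ u → eval (λ v → eval h (u *W v)) q) p
eval-⋆ h [] q = refl
eval-⋆ h ((a , u) ∷ p) q =
  trans (eval-⊕ h (concatMap _ q) (p ⋆ q)) (cong₂ _+_ (row (λ _ _ → refl) q) (eval-⋆ h p q))
  where
  row : ∀ {F} → (∀ b v → F (b , v) ≡ (a * b) · (u *W v)) →
        ∀ q → eval h (concatMap F q) ≡ a * eval (λ v → eval h (u *W v)) q
  row F≡ [] = sym (*-zeroʳ a)
  row F≡ ((b , v) ∷ q) rewrite F≡ b v = trans (eval-⊕ h ((a * b) · (u *W v)) _)
    (trans (cong₂ _+_ (eval-· h (a * b) (u *W v)) (row F≡ q)) (factor-*ˡ a b (eval h (u *W v)) _))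

eval-swap : ∀ (K : Word → Word → ℚ) p q →
  eval (λ u → eval (K u) q) p ≡ eval (λ v → eval (λ u → K u v) p) q
eval-swap K [] q = sym (eval-0 q)
eval-swap K ((a , u) ∷ p) q = begin
  a * eval (K u) q + eval (λ u → eval (K u) q) p
    ≡⟨ cong₂ _+_ (sym (eval-* a (K u) q)) (eval-swap K p q) ⟩
  eval (λ v → a * K u v) q + eval (λ v → eval (λ u → K u v) p) q
    ≡⟨ sym (eval-+ (λ v → a * K u v) (λ v → eval (λ u → K u v) p) q) ⟩
  eval (λ v → a * K u v + eval (λ u → K u v) p) q ∎
  where open ≡-Reasoning

-- Polynomials are lists of terms with repetitions; we compare them by the values of all
-- functionals Word → ℚ.  This is coefficientwise equality (≋⇒≈), but it is a congruence for
-- every operation by a computation in ℚ.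

infix 4 _≋_
record _≋_ (p q : Poly) : Set where
  constructor mk≋
  field eval-≡ : ∀ h → eval h p ≡ eval h q
open _≋_ public

≋-refl : ∀ {p} → p ≋ p
≋-refl = mk≋ λ h → refl

≋-sym : ∀ {p q} → p ≋ q → q ≋ p
≋-sym p≋q = mk≋ λ h → sym (eval-≡ p≋q h)

≋-trans : ∀ {p q r} → p ≋ q → q ≋ r → p ≋ r
≋-trans p≋q q≋r = mk≋ λ h → trans (eval-≡ p≋q h) (eval-≡ q≋r h)

module ≋-Reasoning where
  open import Relation.Binary.Reasoning.Base.Single _≋_ ≋-refl ≋-trans public
    hiding (step-∼)
  open import Relation.Binary.Reasoning.Syntax using (module ≋-syntax)
  open ≋-syntax _IsRelatedTo_ _IsRelatedTo_ ∼-go ≋-sym public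

coeff-as-eval : ∀ p u → coeff p u ≡ eval (λ w → if w ==W u then 1ℚ else 0ℚ) p
coeff-as-eval [] u = refl
coeff-as-eval ((a , v) ∷ p) u with v ==W u
... | true  = cong₂ _+_ (sym (*-identityʳ a)) (coeff-as-eval p u)
... | false = trans (coeff-as-eval p u) (sym (trans (cong (_+ _) (*-zeroʳ a)) (+-identityˡ _)))

≋⇒≈ : ∀ {p q} → p ≋ q → p ≈ q
≋⇒≈ {p} {q} p≋q u = trans (coeff-as-eval p u) (trans (eval-≡ p≋q _) (sym (coeff-as-eval q u)))

record Linear (F : Poly → Poly) : Set where
  constructor mkLinear
  field eval-decompose : ∀ h p → eval h (F p) ≡ eval (λ w → eval h (F (mon w))) p
open Linear public

linear-cong : ∀ {F} → Linear F → ∀ {p q} → p ≋ q → F p ≋ F q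
linear-cong L {p} {q} p≋q = mk≋ λ h →
  trans (eval-decompose L h p) (trans (eval-≡ p≋q _) (sym (eval-decompose L h q)))

linear-ext : ∀ {F G} → Linear F → Linear G → (∀ w → F (mon w) ≋ G (mon w)) → ∀ p → F p ≋ G p
linear-ext LF LG F≋G p = mk≋ λ h →
  trans (eval-decompose LF h p) (trans (eval-cong p (λ w → eval-≡ (F≋G w) h)) (sym (eval-decompose LG h p)))

bilinear-ext : ∀ (B C : Poly → Poly → Poly) →
  (∀ q → Linear (λ p → B p q)) → (∀ p → Linear (B p)) →
  (∀ q → Linear (λ p → C p q)) → (∀ p → Linear (C p)) →
  (∀ u v → B (mon u) (mon v) ≋ C (mon u) (mon v)) → ∀ p q → B p q ≋ C p q
bilinear-ext B C LBˡ LBʳ LCˡ LCʳ B≋C p q =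
  linear-ext (LBˡ q) (LCˡ q) (λ u → linear-ext (LBʳ (mon u)) (LCʳ (mon u)) (B≋C u) q) p

linear-⊕ : ∀ {F} → Linear F → ∀ p q → F (p ⊕ q) ≋ F p ⊕ F q
linear-⊕ {F} L p q = mk≋ λ h → begin
  eval h (F (p ⊕ q))                    ≡⟨ eval-decompose L h (p ⊕ q) ⟩
  eval _ (p ⊕ q)                        ≡⟨ eval-⊕ _ p q ⟩
  eval _ p + eval _ q                   ≡⟨ cong₂ _+_ (eval-decompose L h p) (eval-decompose L h q) ⟨
  eval h (F p) + eval h (F q)           ≡⟨ eval-⊕ h (F p) (F q) ⟨
  eval h (F p ⊕ F q)                    ∎
  where open ≡-Reasoning

linear-· : ∀ {F} → Linear F → ∀ k p → F (k · p) ≋ k · F p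
linear-· {F} L k p = mk≋ λ h → begin
  eval h (F (k · p))                    ≡⟨ eval-decompose L h (k · p) ⟩
  eval _ (k · p)                        ≡⟨ eval-· _ k p ⟩
  k * eval _ p                          ≡⟨ cong (k *_) (eval-decompose L h p) ⟨
  k * eval h (F p)                      ≡⟨ eval-· h k (F p) ⟨
  eval h (k · F p)                      ∎
  where open ≡-Reasoning

linear-0 : ∀ {F} → Linear F → F 0P ≋ 0P
linear-0 L = mk≋ λ h → eval-decompose L h []

lin-linear : ∀ f → Linear (lin f)
lin-linear f = mkLinear λ h p → trans (eval-lin h f p)
  (eval-cong p (λ w → sym (trans (eval-lin h f (mon w)) (eval-mon (λ w → eval h (f w)) w))))

id-linear : Linear (λ p → p)
id-linear = mkLinear λ h p → eval-cong p (λ w → sym (eval-mon h w))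

∘-linear : ∀ {F G} → Linear F → Linear G → Linear (F ∘ G)
∘-linear {F} {G} LF LG = mkLinear λ h p →
  trans (eval-decompose LF h (G p))
    (trans (eval-decompose LG _ p) (eval-cong p (λ w → sym (eval-decompose LF h (G (mon w))))))

⊕-linear : ∀ {F G} → Linear F → Linear G → Linear (λ p → F p ⊕ G p)
⊕-linear {F} {G} LF LG = mkLinear λ h p →
  trans (eval-⊕ h (F p) (G p))
    (trans (cong₂ _+_ (eval-decompose LF h p) (eval-decompose LG h p))
      (trans (sym (eval-+ _ _ p)) (eval-cong p (λ w → sym (eval-⊕ h (F (mon w)) (G (mon w)))))))

·-linear : ∀ {F} k → Linear F → Linear (λ p → k · F p)
·-linear {F} k LF = mkLinear λ h p →
  trans (eval-· h k (F p))
    (trans (cong (k *_) (eval-decompose LF h p))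
      (trans (sym (eval-* k _ p)) (eval-cong p (λ w → sym (eval-· h k (F (mon w)))))))

⊖-linear : ∀ {F G} → Linear F → Linear G → Linear (λ p → F p ⊖ G p)
⊖-linear LF LG = ⊕-linear LF (·-linear (- 1ℚ) LG)

pre-linear : ∀ l → Linear (pre l)
pre-linear l = mkLinear λ h p →
  trans (eval-pre h l p) (eval-cong p (λ w → sym (trans (eval-pre h l (mon w)) (eval-mon (h ∘ (l ∷_)) w))))

⊗ˡ-linear : ∀ q → Linear (_⊗ q)
⊗ˡ-linear q = mkLinear λ h p →
  trans (eval-⊗ h p q) (eval-cong p (λ u → sym (trans (eval-⊗ h (mon u) q) (eval-mon (λ u → eval (λ v → h (u ++ v)) q) u))))

⊗ʳ-linear : ∀ p → Linear (p ⊗_)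
⊗ʳ-linear p = mkLinear λ h q →
  trans (eval-⊗ h p q) (trans (eval-swap (λ u v → h (u ++ v)) p q)
    (eval-cong q (λ v → sym (trans (eval-⊗ h p (mon v)) (eval-cong p (λ u → eval-mon (λ v → h (u ++ v)) v))))))

⋆ˡ-linear : ∀ q → Linear (_⋆ q)
⋆ˡ-linear q = mkLinear λ h p →
  trans (eval-⋆ h p q) (eval-cong p (λ u → sym (trans (eval-⋆ h (mon u) q) (eval-mon (λ u → eval (λ v → eval h (u *W v)) q) u))))

⋆ʳ-linear : ∀ p → Linear (p ⋆_)
⋆ʳ-linear p = mkLinear λ h q →
  trans (eval-⋆ h p q) (trans (eval-swap (λ u v → eval h (u *W v)) p q)
    (eval-cong q (λ v → sym (trans (eval-⋆ h p (mon v)) (eval-cong p (λ u → eval-mon (λ v → eval h (u *W v)) v))))))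

lin-cong : ∀ f {p q} → p ≋ q → lin f p ≋ lin f q
lin-cong f = linear-cong (lin-linear f)

lin-mon : ∀ f w → lin f (mon w) ≋ f w
lin-mon f w = mk≋ λ h → trans (eval-lin h f (mon w)) (eval-mon (λ w → eval h (f w)) w)

⊕-cong : ∀ {p p' q q'} → p ≋ p' → q ≋ q' → p ⊕ q ≋ p' ⊕ q'
⊕-cong {p} {p'} {q} {q'} p≋p' q≋q' = mk≋ λ h →
  trans (eval-⊕ h p q) (trans (cong₂ _+_ (eval-≡ p≋p' h) (eval-≡ q≋q' h)) (sym (eval-⊕ h p' q')))

⊕-congˡ : ∀ p {q q'} → q ≋ q' → p ⊕ q ≋ p ⊕ q'
⊕-congˡ p = ⊕-cong (≋-refl {p})

⊕-congʳ : ∀ q {p p'} → p ≋ p' → p ⊕ q ≋ p' ⊕ q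
⊕-congʳ q p≋p' = ⊕-cong p≋p' (≋-refl {q})

⊕-identityʳ : ∀ p → p ⊕ 0P ≋ p
⊕-identityʳ p = mk≋ λ h → cong (eval h) (++-identityʳ p)

linear-⊕₃ : ∀ {F} → Linear F → ∀ p q r → F (p ⊕ q ⊕ r) ≋ F p ⊕ F q ⊕ F r
linear-⊕₃ {F} L p q r = ≋-trans (linear-⊕ L (p ⊕ q) r) (⊕-congʳ (F r) (linear-⊕ L p q))

linear-⊖ : ∀ {F} → Linear F → ∀ p q → F (p ⊖ q) ≋ F p ⊖ F q
linear-⊖ {F} L p q = ≋-trans (linear-⊕ L p ((- 1ℚ) · q)) (⊕-congˡ (F p) (linear-· L (- 1ℚ) q))

·-cong : ∀ k {p q} → p ≋ q → k · p ≋ k · q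
·-cong k = linear-cong (·-linear k id-linear)

⊖-cong : ∀ {p p' q q'} → p ≋ p' → q ≋ q' → p ⊖ q ≋ p' ⊖ q'
⊖-cong p≋p' q≋q' = ⊕-cong p≋p' (·-cong (- 1ℚ) q≋q')

pre-cong : ∀ l {p q} → p ≋ q → pre l p ≋ pre l q
pre-cong l = linear-cong (pre-linear l)

⊗-cong : ∀ {p p' q q'} → p ≋ p' → q ≋ q' → p ⊗ q ≋ p' ⊗ q'
⊗-cong {p' = p'} {q = q} p≋p' q≋q' =
  ≋-trans (linear-cong (⊗ˡ-linear q) p≋p') (linear-cong (⊗ʳ-linear p') q≋q')

⊗-congˡ : ∀ p {q q'} → q ≋ q' → p ⊗ q ≋ p ⊗ q'
⊗-congˡ p = ⊗-cong (≋-refl {p})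

⊗-congʳ : ∀ q {p p'} → p ≋ p' → p ⊗ q ≋ p' ⊗ q
⊗-congʳ q p≋p' = ⊗-cong p≋p' (≋-refl {q})

⋆-cong : ∀ {p p' q q'} → p ≋ p' → q ≋ q' → p ⋆ q ≋ p' ⋆ q'
⋆-cong {p' = p'} {q = q} p≋p' q≋q' =
  ≋-trans (linear-cong (⋆ˡ-linear q) p≋p') (linear-cong (⋆ʳ-linear p') q≋q')

⋆-congˡ : ∀ p {q q'} → q ≋ q' → p ⋆ q ≋ p ⋆ q'
⋆-congˡ p = ⋆-cong (≋-refl {p})

⋆-congʳ : ∀ q {p p'} → p ≋ p' → p ⋆ q ≋ p' ⋆ q
⋆-congʳ q p≋p' = ⋆-cong p≋p' (≋-refl {q})

·-distribʳ : ∀ k m p → k · p ⊕ m · p ≋ (k + m) · p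
·-distribʳ k m p = mk≋ λ h → begin
  eval h (k · p ⊕ m · p)            ≡⟨ eval-⊕ h (k · p) (m · p) ⟩
  eval h (k · p) + eval h (m · p)   ≡⟨ cong₂ _+_ (eval-· h k p) (eval-· h m p) ⟩
  k * eval h p + m * eval h p       ≡⟨ *-distribʳ-+ (eval h p) k m ⟨
  (k + m) * eval h p                ≡⟨ eval-· h (k + m) p ⟨
  eval h ((k + m) · p)              ∎
  where open ≡-Reasoning

·-identityˡ : ∀ p → 1ℚ · p ≋ p
·-identityˡ p = mk≋ λ h → trans (eval-· h 1ℚ p) (*-identityˡ (eval h p))

·-cong-≡ : ∀ {k m} p → k ≡ m → k · p ≋ m · p
·-cong-≡ p refl = ≋-refl

mon-⊗ : ∀ u v → mon u ⊗ mon v ≋ mon (u ++ v)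
mon-⊗ u v = mk≋ λ h →
  trans (eval-⊗ h (mon u) (mon v))
    (trans (eval-mon (λ u → eval (λ v → h (u ++ v)) (mon v)) u) (trans (eval-mon (λ v → h (u ++ v)) v) (sym (eval-mon h (u ++ v)))))

mon-⋆ : ∀ u v → mon u ⋆ mon v ≋ u *W v
mon-⋆ u v = mk≋ λ h → trans (eval-⋆ h (mon u) (mon v))
  (trans (eval-mon (λ u → eval (λ v → eval h (u *W v)) (mon v)) u) (eval-mon (λ v → eval h (u *W v)) v))

⊗-assoc : ∀ p q r → (p ⊗ q) ⊗ r ≋ p ⊗ (q ⊗ r)
⊗-assoc p q r = mk≋ λ h → begin
  eval h ((p ⊗ q) ⊗ r)
    ≡⟨ trans (eval-⊗ h (p ⊗ q) r) (eval-⊗ _ p q) ⟩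
  eval (λ u → eval (λ v → eval (λ t → h ((u ++ v) ++ t)) r) q) p
    ≡⟨ eval-cong p (λ u → eval-cong q (λ v → eval-cong r (λ t → cong h (++-assoc u v t)))) ⟩
  eval (λ u → eval (λ v → eval (λ t → h (u ++ (v ++ t))) r) q) p
    ≡⟨ trans (eval-⊗ h p (q ⊗ r)) (eval-cong p (λ u → eval-⊗ _ q r)) ⟨
  eval h (p ⊗ (q ⊗ r)) ∎
  where open ≡-Reasoning

⊗-identityˡ : ∀ p → mon [] ⊗ p ≋ p
⊗-identityˡ p = mk≋ λ h → trans (eval-⊗ h (mon []) p) (eval-mon (λ u → eval (λ v → h (u ++ v)) p) [])

⊗-identityʳ : ∀ p → p ⊗ mon [] ≋ p
⊗-identityʳ p = mk≋ λ h →
  trans (eval-⊗ h p (mon [])) (eval-cong p (λ u → trans (eval-mon (λ v → h (u ++ v)) []) (cong h (++-identityʳ u))))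

letter-⊗ : ∀ l p → mon (l ∷ []) ⊗ p ≋ pre l p
letter-⊗ l p = mk≋ λ h →
  trans (eval-⊗ h (mon (l ∷ [])) p) (trans (eval-mon (λ u → eval (λ v → h (u ++ v)) p) (l ∷ [])) (sym (eval-pre h l p)))

pre-⊗ : ∀ l p q → pre l (p ⊗ q) ≋ pre l p ⊗ q
pre-⊗ l p q = mk≋ λ h →
  trans (eval-pre h l (p ⊗ q)) (trans (eval-⊗ _ p q) (sym (trans (eval-⊗ h (pre l p) q) (eval-pre _ l p))))

pre-⊕ : ∀ l p q → pre l (p ⊕ q) ≋ pre l p ⊕ pre l q
pre-⊕ l = linear-⊕ (pre-linear l)

pre-· : ∀ l k p → pre l (k · p) ≋ k · pre l p
pre-· l = linear-· (pre-linear l)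

⊗-distribʳ-⊕ : ∀ p q r → (p ⊕ q) ⊗ r ≋ p ⊗ r ⊕ q ⊗ r
⊗-distribʳ-⊕ p q r = linear-⊕ (⊗ˡ-linear r) p q

⊗-distribʳ-⊖ : ∀ p q r → (p ⊖ q) ⊗ r ≋ p ⊗ r ⊖ q ⊗ r
⊗-distribʳ-⊖ p q r = ≋-trans (⊗-distribʳ-⊕ p ((- 1ℚ) · q) r) (⊕-congˡ (p ⊗ r) (linear-· (⊗ˡ-linear r) (- 1ℚ) q))

·-⊗ : ∀ k p q → (k · p) ⊗ q ≋ k · (p ⊗ q)
·-⊗ k p q = linear-· (⊗ˡ-linear q) k p

⊗-· : ∀ k p q → p ⊗ (k · q) ≋ k · (p ⊗ q)
⊗-· k p = linear-· (⊗ʳ-linear p) k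

⊗-zeroˡ : ∀ {p} → p ≋ 0P → ∀ q → p ⊗ q ≋ 0P
⊗-zeroˡ {p} p≋0 q = ⊗-congʳ q p≋0

⊗-zeroʳ : ∀ p {q} → q ≋ 0P → p ⊗ q ≋ 0P
⊗-zeroʳ p q≋0 = ≋-trans (⊗-congˡ p q≋0) (linear-0 (⊗ʳ-linear p))

-- It decides identities between linear combinations of letter-prefixed atoms, over ℚ
-- extended by a symbolic scalar c and with a symbolic letter l.

infixl 6 _⊞_ _⊟_
infixr 7 _⊡_
infixr 8 _◃_ c⊡_ l◃_
infix 4 _⊜_

data LinExpr (n : ℕ) : Set where
  var     : Fin n → LinExpr n
  con     : Poly → LinExpr n
  _⊞_ _⊟_ : LinExpr n → LinExpr n → LinExpr n
  _⊡_     : ℚ → LinExpr n → LinExpr n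
  c⊡_     : LinExpr n → LinExpr n
  _◃_     : Letter → LinExpr n → LinExpr n
  l◃_     : LinExpr n → LinExpr n

⟦_⟧ : ∀ {n} → LinExpr n → ℚ → Letter → Vec Poly n → Poly
⟦ var i ⟧ c l ρ = lookup ρ i
⟦ con p ⟧ c l ρ = p
⟦ e ⊞ e' ⟧ c l ρ = ⟦ e ⟧ c l ρ ⊕ ⟦ e' ⟧ c l ρ
⟦ e ⊟ e' ⟧ c l ρ = ⟦ e ⟧ c l ρ ⊖ ⟦ e' ⟧ c l ρ
⟦ k ⊡ e ⟧ c l ρ = k · ⟦ e ⟧ c l ρ
⟦ c⊡ e ⟧ c l ρ = c · ⟦ e ⟧ c l ρ
⟦ a ◃ e ⟧ c l ρ = pre a (⟦ e ⟧ c l ρ)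
⟦ l◃ e ⟧ c l ρ = pre l (⟦ e ⟧ c l ρ)

_^_ : ℚ → ℕ → ℚ
c ^ zero = 1ℚ
c ^ suc m = c * c ^ m

data Symbol : Set where
  fixed : Letter → Symbol
  param : Symbol

instantiate : Letter → List Symbol → Word
instantiate l = map λ { (fixed a) → a ; param → l }

-- A term (k , m , w , a) stands for k c^m times the word w followed by the
-- atom a, where the atom nothing is the empty word.
Term : ℕ → Set
Term n = ℚ × ℕ × List Symbol × Maybe (Fin n)

atom : ∀ {n} → Vec Poly n → Maybe (Fin n) → Poly
atom ρ nothing = mon []
atom ρ (just i) = lookup ρ i

evalᵃ : ∀ {n} → (Word → ℚ) → Letter → Vec Poly n → List Symbol → Maybe (Fin n) → ℚ
evalᵃ h l ρ w a = eval (λ t → h (instantiate l w ++ t)) (atom ρ a)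

module _ {n} (h : Word → ℚ) (c : ℚ) (l : Letter) (ρ : Vec Poly n) where

  evalᵗ : Term n → ℚ
  evalᵗ (k , m , w , a) = k * c ^ m * evalᵃ h l ρ w a

  evalⁿ : List (Term n) → ℚ
  evalⁿ [] = 0ℚ
  evalⁿ (t ∷ ts) = evalᵗ t + evalⁿ ts

scaleⁿ : ∀ {n} → ℚ → List (Term n) → List (Term n)
scaleⁿ k = map λ { (k' , m , w , a) → (k * k' , m , w , a) }

c-scaleⁿ : ∀ {n} → List (Term n) → List (Term n)
c-scaleⁿ = map λ { (k , m , w , a) → (k , suc m , w , a) }

prefixⁿ : ∀ {n} → Symbol → List (Term n) → List (Term n)
prefixⁿ s = map λ { (k , m , w , a) → (k , m , s ∷ w , a) }

literalⁿ : ∀ {n} → Poly → List (Term n)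
literalⁿ = map λ { (k , w) → (k , 0 , map fixed w , nothing) }

normalise : ∀ {n} → LinExpr n → List (Term n)
normalise (var i) = (1ℚ , 0 , [] , just i) ∷ []
normalise (con p) = literalⁿ p
normalise (e ⊞ e') = normalise e ++ normalise e'
normalise (e ⊟ e') = normalise e ++ scaleⁿ (- 1ℚ) (normalise e')
normalise (k ⊡ e) = scaleⁿ k (normalise e)
normalise (c⊡ e) = c-scaleⁿ (normalise e)
normalise (a ◃ e) = prefixⁿ (fixed a) (normalise e)
normalise (l◃ e) = prefixⁿ param (normalise e)

≟-symbol : (s s' : Symbol) → Dec (s ≡ s')
≟-symbol (fixed X) (fixed X) = yes refl
≟-symbol (fixed Y) (fixed Y) = yes refl
≟-symbol param param = yes refl
≟-symbol (fixed X) (fixed Y) = no λ ()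
≟-symbol (fixed Y) (fixed X) = no λ ()
≟-symbol (fixed _) param = no λ ()
≟-symbol param (fixed _) = no λ ()

≟-word : (u v : List Symbol) → Dec (u ≡ v)
≟-word [] [] = yes refl
≟-word [] (_ ∷ _) = no λ ()
≟-word (_ ∷ _) [] = no λ ()
≟-word (s ∷ u) (s' ∷ v) with ≟-symbol s s' | ≟-word u v
... | yes refl | yes refl = yes refl
... | no s≢s'  | _        = no λ { refl → s≢s' refl }
... | yes _    | no u≢v   = no λ { refl → u≢v refl }

≟-atom : ∀ {n} (a b : Maybe (Fin n)) → Dec (a ≡ b)
≟-atom nothing nothing = yes refl
≟-atom nothing (just _) = no λ ()
≟-atom (just _) nothing = no λ ()
≟-atom (just i) (just j) with i ≟ᶠ j
... | yes refl = yes refl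
... | no i≢j   = no λ { refl → i≢j refl }

≟-monomial : ∀ {n} (s s' : ℕ × List Symbol × Maybe (Fin n)) → Dec (s ≡ s')
≟-monomial (m , w , a) (m' , w' , a') with m ℕ.≟ m' | ≟-word w w' | ≟-atom a a'
... | yes refl | yes refl | yes refl = yes refl
... | no m≢m'  | _        | _        = no λ { refl → m≢m' refl }
... | yes _    | no w≢w'  | _        = no λ { refl → w≢w' refl }
... | yes _    | yes _    | no a≢a'  = no λ { refl → a≢a' refl }

insert : ∀ {n} → Term n → List (Term n) → List (Term n)
insert (k , s) [] with k ≟ℚ 0ℚ
... | yes _ = []
... | no _  = (k , s) ∷ []
insert (k , s) ((k' , s') ∷ ts) with ≟-monomial s s'
... | no _ = (k' , s') ∷ insert (k , s) ts
... | yes _ with k + k' ≟ℚ 0ℚ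
...   | yes _ = ts
...   | no _  = (k + k' , s) ∷ ts

collect : ∀ {n} → List (Term n) → List (Term n)
collect [] = []
collect (t ∷ ts) = insert t (collect ts)

module _ {n} (h : Word → ℚ) (c : ℚ) (l : Letter) (ρ : Vec Poly n) where

  private
    merge : ∀ k k' d e r → k * d * e + (k' * d * e + r) ≡ (k + k') * d * e + r
    merge = solve-∀ ℚ-ring
    vanish : ∀ d e r → 0ℚ * d * e + r ≡ r
    vanish = solve-∀ ℚ-ring
    swap-+ : ∀ a b r → a + (b + r) ≡ b + (a + r)
    swap-+ = solve-∀ ℚ-ring

  insert-sound : ∀ t ts → evalⁿ h c l ρ (insert t ts) ≡ evalᵗ h c l ρ t + evalⁿ h c l ρ ts
  insert-sound (k , m , w , a) [] with k ≟ℚ 0ℚ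
  ... | yes refl = sym (vanish (c ^ m) (evalᵃ h l ρ w a) 0ℚ)
  ... | no _     = refl
  insert-sound (k , s) ((k' , s') ∷ ts) with ≟-monomial s s'
  ... | no _ = trans (cong (evalᵗ h c l ρ (k' , s') +_) (insert-sound (k , s) ts))
                     (swap-+ (evalᵗ h c l ρ (k' , s')) (evalᵗ h c l ρ (k , s)) (evalⁿ h c l ρ ts))
  insert-sound (k , m , w , a) ((k' , _) ∷ ts) | yes refl with k + k' ≟ℚ 0ℚ
  ...   | yes k+k'≡0 = sym (trans (merge k k' (c ^ m) e r) (trans (cong (λ κ → κ * c ^ m * e + r) k+k'≡0) (vanish (c ^ m) e r)))
    where
    e r : ℚ
    e = evalᵃ h l ρ w a
    r = evalⁿ h c l ρ ts
  ...   | no _ = sym (merge k k' (c ^ m) (evalᵃ h l ρ w a) (evalⁿ h c l ρ ts))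

  collect-sound : ∀ ts → evalⁿ h c l ρ (collect ts) ≡ evalⁿ h c l ρ ts
  collect-sound [] = refl
  collect-sound (t ∷ ts) =
    trans (insert-sound t (collect ts)) (cong (evalᵗ h c l ρ t +_) (collect-sound ts))

  evalⁿ-++ : ∀ ts ts' → evalⁿ h c l ρ (ts ++ ts') ≡ evalⁿ h c l ρ ts + evalⁿ h c l ρ ts'
  evalⁿ-++ [] ts' = sym (+-identityˡ (evalⁿ h c l ρ ts'))
  evalⁿ-++ (t ∷ ts) ts' = trans (cong (evalᵗ h c l ρ t +_) (evalⁿ-++ ts ts'))
    (sym (+-assoc (evalᵗ h c l ρ t) (evalⁿ h c l ρ ts) (evalⁿ h c l ρ ts')))

  evalⁿ-scale : ∀ k ts → evalⁿ h c l ρ (scaleⁿ k ts) ≡ k * evalⁿ h c l ρ ts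
  evalⁿ-scale k [] = sym (*-zeroʳ k)
  evalⁿ-scale k ((k' , m , w , a) ∷ ts) =
    trans (cong₂ _+_ (regroup k k' (c ^ m) e) (evalⁿ-scale k ts))
          (sym (*-distribˡ-+ k (k' * c ^ m * e) (evalⁿ h c l ρ ts)))
    where
    e : ℚ
    e = evalᵃ h l ρ w a
    regroup : ∀ k k' d e → k * k' * d * e ≡ k * (k' * d * e)
    regroup = solve-∀ ℚ-ring

  evalⁿ-c-scale : ∀ ts → evalⁿ h c l ρ (c-scaleⁿ ts) ≡ c * evalⁿ h c l ρ ts
  evalⁿ-c-scale [] = sym (*-zeroʳ c)
  evalⁿ-c-scale ((k , m , w , a) ∷ ts) =
    trans (cong₂ _+_ (shift c k (c ^ m) e) (evalⁿ-c-scale ts))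
          (sym (*-distribˡ-+ c (k * c ^ m * e) (evalⁿ h c l ρ ts)))
    where
    e : ℚ
    e = evalᵃ h l ρ w a
    shift : ∀ c k d e → k * (c * d) * e ≡ c * (k * d * e)
    shift = solve-∀ ℚ-ring

evalⁿ-prefix : ∀ {n} h c l (ρ : Vec Poly n) s ts →
  evalⁿ h c l ρ (prefixⁿ s ts) ≡ evalⁿ (h ∘ (instantiate l (s ∷ []) ++_)) c l ρ ts
evalⁿ-prefix h c l ρ s [] = refl
evalⁿ-prefix h c l ρ s ((k , m , w , a) ∷ ts) =
  cong (k * c ^ m * evalᵃ h l ρ (s ∷ w) a +_) (evalⁿ-prefix h c l ρ s ts)

evalⁿ-literal : ∀ {n} h c l (ρ : Vec Poly n) p → evalⁿ h c l ρ (literalⁿ p) ≡ eval h p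
evalⁿ-literal h c l ρ [] = refl
evalⁿ-literal h c l ρ ((k , w) ∷ p) = cong₂ _+_
  (trans (cong (_* evalᵃ h l ρ (map fixed w) nothing) (*-identityʳ k))
    (cong (k *_) (trans (eval-mon (λ t → h (instantiate l (map fixed w) ++ t)) [])
      (cong h (trans (++-identityʳ _) (instantiate-fixed w))))))
  (evalⁿ-literal h c l ρ p)
  where
  instantiate-fixed : ∀ w → instantiate l (map fixed w) ≡ w
  instantiate-fixed [] = refl
  instantiate-fixed (a ∷ w) = cong (a ∷_) (instantiate-fixed w)

normalise-sound : ∀ {n} h c l (e : LinExpr n) ρ → eval h (⟦ e ⟧ c l ρ) ≡ evalⁿ h c l ρ (normalise e)
normalise-sound h c l (var i) ρ =
  sym (trans (+-identityʳ _) (trans (cong (_* evalᵃ h l ρ [] (just i)) (*-identityˡ 1ℚ))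
    (trans (*-identityˡ _) (eval-cong (lookup ρ i) (λ t → refl)))))
normalise-sound h c l (con p) ρ = sym (evalⁿ-literal h c l ρ p)
normalise-sound h c l (e ⊞ e') ρ = trans (eval-⊕ h (⟦ e ⟧ c l ρ) (⟦ e' ⟧ c l ρ))
  (trans (cong₂ _+_ (normalise-sound h c l e ρ) (normalise-sound h c l e' ρ))
    (sym (evalⁿ-++ h c l ρ (normalise e) (normalise e'))))
normalise-sound h c l (e ⊟ e') ρ = trans (eval-⊕ h (⟦ e ⟧ c l ρ) ((- 1ℚ) · ⟦ e' ⟧ c l ρ))
  (trans (cong₂ _+_ (normalise-sound h c l e ρ)
           (trans (eval-· h (- 1ℚ) (⟦ e' ⟧ c l ρ))
             (trans (cong (- 1ℚ *_) (normalise-sound h c l e' ρ))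
               (sym (evalⁿ-scale h c l ρ (- 1ℚ) (normalise e'))))))
    (sym (evalⁿ-++ h c l ρ (normalise e) (scaleⁿ (- 1ℚ) (normalise e')))))
normalise-sound h c l (k ⊡ e) ρ = trans (eval-· h k (⟦ e ⟧ c l ρ))
  (trans (cong (k *_) (normalise-sound h c l e ρ)) (sym (evalⁿ-scale h c l ρ k (normalise e))))
normalise-sound h c l (c⊡ e) ρ = trans (eval-· h c (⟦ e ⟧ c l ρ))
  (trans (cong (c *_) (normalise-sound h c l e ρ)) (sym (evalⁿ-c-scale h c l ρ (normalise e))))
normalise-sound h c l (a ◃ e) ρ = trans (eval-pre h a (⟦ e ⟧ c l ρ))
  (trans (normalise-sound (h ∘ (a ∷_)) c l e ρ) (sym (evalⁿ-prefix h c l ρ (fixed a) (normalise e))))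
normalise-sound h c l (l◃ e) ρ = trans (eval-pre h l (⟦ e ⟧ c l ρ))
  (trans (normalise-sound (h ∘ (l ∷_)) c l e ρ) (sym (evalⁿ-prefix h c l ρ param (normalise e))))

Decided : ∀ {n} → LinExpr n → LinExpr n → Set
Decided e e' = collect (normalise (e ⊟ e')) ≡ []

prove : ∀ {n} (e e' : LinExpr n) → Decided e e' → ∀ c l ρ → ⟦ e ⟧ c l ρ ≋ ⟦ e' ⟧ c l ρ
prove e e' decided c l ρ = mk≋ λ h → begin
  eval h E                                ≡⟨ cancel (eval h E) (eval h E') ⟨
  eval h E + - 1ℚ * eval h E' + eval h E' ≡⟨ cong (_+ eval h E') (difference-zero h) ⟩
  0ℚ + eval h E'                          ≡⟨ +-identityˡ (eval h E') ⟩
  eval h E'                               ∎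
  where
  open ≡-Reasoning
  E E' : Poly
  E = ⟦ e ⟧ c l ρ
  E' = ⟦ e' ⟧ c l ρ
  cancel : ∀ a b → a + - 1ℚ * b + b ≡ a
  cancel = solve-∀ ℚ-ring
  difference-zero : ∀ h → eval h E + - 1ℚ * eval h E' ≡ 0ℚ
  difference-zero h = begin
    eval h E + - 1ℚ * eval h E'                  ≡⟨ cong (eval h E +_) (eval-· h (- 1ℚ) E') ⟨
    eval h E + eval h ((- 1ℚ) · E')              ≡⟨ eval-⊕ h E ((- 1ℚ) · E') ⟨
    eval h (⟦ e ⊟ e' ⟧ c l ρ)                    ≡⟨ normalise-sound h c l (e ⊟ e') ρ ⟩
    evalⁿ h c l ρ (normalise (e ⊟ e'))           ≡⟨ collect-sound h c l ρ (normalise (e ⊟ e')) ⟨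
    evalⁿ h c l ρ (collect (normalise (e ⊟ e'))) ≡⟨ cong (evalⁿ h c l ρ) decided ⟩
    0ℚ                                           ∎

_⊜_ : ∀ {n} → LinExpr n → LinExpr n → LinExpr n × LinExpr n
_⊜_ = _,_

closeⁿ : ∀ {A : Set} n → N-ary n (LinExpr n) A → A
closeⁿ n f = f $ⁿ Vec.map var (allFin n)

solveWith : ∀ c l n (f : N-ary n (LinExpr n) (LinExpr n × LinExpr n)) →
  Decided (proj₁ (closeⁿ n f)) (proj₂ (closeⁿ n f)) →
  Eq n _≋_ (curryⁿ (⟦ proj₁ (closeⁿ n f) ⟧ c l)) (curryⁿ (⟦ proj₂ (closeⁿ n f) ⟧ c l))
solveWith c l n f decided =
  curryⁿ-cong _≋_ _ _ (prove (proj₁ (closeⁿ n f)) (proj₂ (closeⁿ n f)) decided c l)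

solve : ∀ n (f : N-ary n (LinExpr n) (LinExpr n × LinExpr n)) →
  Decided (proj₁ (closeⁿ n f)) (proj₂ (closeⁿ n f)) →
  Eq n _≋_ (curryⁿ (⟦ proj₁ (closeⁿ n f) ⟧ 0ℚ X)) (curryⁿ (⟦ proj₂ (closeⁿ n f) ⟧ 0ℚ X))
solve = solveWith 0ℚ X

compute : ∀ {p q} → Decided {0} (con p) (con q) → p ≋ q
compute {p} {q} decided = prove (con p) (con q) decided 0ℚ X Vec.[]

fromℕ-suc : ∀ n → fromℕ (suc n) ≡ 1ℚ + fromℕ n
fromℕ-suc n = sym (trans (cong (1ℚ +_) (normalize-coprime (coprime-sym (1-coprimeTo n)))) (/-cong sum refl))
  where
  sum : ℤ.+ 1 ℤ.* ℤ.+ 1 ℤ.+ ℤ.+ n ℤ.* ℤ.+ 1 ≡ ℤ.+ suc n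
  sum = cong (λ t → ℤ.+ 1 ℤ.+ t) (ℤ.*-identityʳ (ℤ.+ n))

lin-pre : ∀ f l {G} → Linear G → (∀ u → f (l ∷ u) ≋ G (mon u)) → ∀ p → lin f (pre l p) ≋ G p
lin-pre f l LG f≋G = linear-ext (∘-linear (lin-linear f) (pre-linear l)) LG λ u →
  ≋-trans (lin-mon f (l ∷ u)) (f≋G u)

∂₁-linear : Linear ∂₁
∂₁-linear = lin-linear ∂₁W

H-linear : Linear H
H-linear = lin-linear (λ w → fromℕ (length w) · mon w)

θ-linear : ∀ c → Linear (θ c)
θ-linear c = lin-linear (θW c)

θ̃-linear : ∀ c → Linear (θ̃ c)
θ̃-linear c = ⊕-linear (θ-linear c) (·-linear c (∘-linear (⊗ˡ-linear y) H-linear))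

∂₁-pre : ∀ l p → ∂₁ (pre l p) ≋ ∂₁L l ⊗ p ⊕ pre l (∂₁ p)
∂₁-pre l = lin-pre ∂₁W l (⊕-linear (⊗ʳ-linear (∂₁L l)) (∘-linear (pre-linear l) ∂₁-linear)) λ u →
  ⊕-congˡ (∂₁L l ⊗ mon u) (pre-cong l (≋-sym (lin-mon ∂₁W u)))

H-pre : ∀ l p → H (pre l p) ≋ pre l p ⊕ pre l (H p)
H-pre l = lin-pre (λ w → fromℕ (length w) · mon w) l (⊕-linear (pre-linear l) (∘-linear (pre-linear l) H-linear)) λ u → begin
  fromℕ (suc (length u)) · mon (l ∷ u)                          ≋⟨ ·-cong-≡ (mon (l ∷ u)) (fromℕ-suc (length u)) ⟩
  (1ℚ + fromℕ (length u)) · mon (l ∷ u)                         ≋⟨ ·-distribʳ 1ℚ (fromℕ (length u)) (mon (l ∷ u)) ⟨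
  1ℚ · mon (l ∷ u) ⊕ fromℕ (length u) · mon (l ∷ u)             ≋⟨ ⊕-cong (·-identityˡ (mon (l ∷ u))) (pre-· l (fromℕ (length u)) (mon u)) ⟨
  mon (l ∷ u) ⊕ pre l (fromℕ (length u) · mon u)                ≋⟨ ⊕-congˡ (mon (l ∷ u)) (pre-cong l (lin-mon (λ w → fromℕ (length w) · mon w) u)) ⟨
  pre l (mon u) ⊕ pre l (H (mon u))                             ∎
  where open ≋-Reasoning

θ-pre : ∀ c l p → θ c (pre l p) ≋ pre l (z ⊗ p) ⊕ pre l (θ c p) ⊕ c · pre l (∂₁ p)
θ-pre c l = lin-pre (θW c) l
  (⊕-linear (⊕-linear (∘-linear (pre-linear l) (⊗ʳ-linear z)) (∘-linear (pre-linear l) (θ-linear c)))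
            (·-linear c (∘-linear (pre-linear l) ∂₁-linear))) λ u →
  ⊕-congʳ (c · pre l (∂₁ (mon u))) (⊕-cong (≋-trans (⊗-assoc (mon (l ∷ [])) z (mon u)) (letter-⊗ l (z ⊗ mon u)))
                  (pre-cong l (≋-sym (lin-mon (θW c) u))))

∂₁-mon-⊗ : ∀ u q → ∂₁ (mon u ⊗ q) ≋ ∂₁ (mon u) ⊗ q ⊕ mon u ⊗ ∂₁ q
∂₁-mon-⊗ [] q = ≋-trans (linear-cong ∂₁-linear (⊗-identityˡ q)) (≋-sym (⊗-identityˡ (∂₁ q)))
∂₁-mon-⊗ (l ∷ u) q = begin
  ∂₁ (pre l U ⊗ q)                                        ≋⟨ linear-cong ∂₁-linear (pre-⊗ l U q) ⟨
  ∂₁ (pre l (U ⊗ q))                                      ≋⟨ ∂₁-pre l (U ⊗ q) ⟩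
  ∂₁L l ⊗ (U ⊗ q) ⊕ pre l (∂₁ (U ⊗ q))                    ≋⟨ ⊕-congˡ (∂₁L l ⊗ (U ⊗ q)) (pre-cong l (∂₁-mon-⊗ u q)) ⟩
  ∂₁L l ⊗ (U ⊗ q) ⊕ pre l (∂₁ U ⊗ q ⊕ U ⊗ ∂₁ q)
    ≋⟨ solveWith 0ℚ l 3 (λ a b d → a ⊞ l◃ (b ⊞ d) ⊜ a ⊞ l◃ b ⊞ l◃ d) refl (∂₁L l ⊗ (U ⊗ q)) (∂₁ U ⊗ q) (U ⊗ ∂₁ q) ⟩
  ∂₁L l ⊗ (U ⊗ q) ⊕ pre l (∂₁ U ⊗ q) ⊕ pre l (U ⊗ ∂₁ q)
    ≋⟨ ⊕-cong (⊕-cong (⊗-assoc (∂₁L l) U q) (≋-sym (pre-⊗ l (∂₁ U) q))) (≋-sym (pre-⊗ l U (∂₁ q))) ⟨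
  (∂₁L l ⊗ U) ⊗ q ⊕ pre l (∂₁ U) ⊗ q ⊕ pre l U ⊗ ∂₁ q
    ≋⟨ ⊕-congʳ (pre l U ⊗ ∂₁ q) (≋-trans (⊗-congʳ q (∂₁-pre l U)) (⊗-distribʳ-⊕ (∂₁L l ⊗ U) (pre l (∂₁ U)) q)) ⟨
  ∂₁ (pre l U) ⊗ q ⊕ pre l U ⊗ ∂₁ q                       ∎
  where
  open ≋-Reasoning
  U : Poly
  U = mon u

∂₁-⊗ : ∀ p q → ∂₁ (p ⊗ q) ≋ ∂₁ p ⊗ q ⊕ p ⊗ ∂₁ q
∂₁-⊗ p q = linear-ext (∘-linear ∂₁-linear (⊗ˡ-linear q))
  (⊕-linear (∘-linear (⊗ˡ-linear q) ∂₁-linear) (⊗ˡ-linear (∂₁ q))) (λ u → ∂₁-mon-⊗ u q) p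

H-empty : H (mon []) ≋ 0P
H-empty = compute refl

θ-pre-⊗ : ∀ c l p q →
  θ c (pre l p) ⊗ q ≋ pre l (z ⊗ (p ⊗ q)) ⊕ pre l (θ c p ⊗ q) ⊕ c · pre l (∂₁ p ⊗ q)
θ-pre-⊗ c l p q = begin
  θ c (pre l p) ⊗ q                                           ≋⟨ ⊗-congʳ q (θ-pre c l p) ⟩
  (pre l (z ⊗ p) ⊕ pre l (θ c p) ⊕ c · pre l (∂₁ p)) ⊗ q
    ≋⟨ linear-⊕₃ (⊗ˡ-linear q) (pre l (z ⊗ p)) (pre l (θ c p)) (c · pre l (∂₁ p)) ⟩
  pre l (z ⊗ p) ⊗ q ⊕ pre l (θ c p) ⊗ q ⊕ (c · pre l (∂₁ p)) ⊗ q
    ≋⟨ ⊕-cong (⊕-cong (≋-trans (≋-sym (pre-⊗ l (z ⊗ p) q)) (pre-cong l (⊗-assoc z p q)))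
                      (≋-sym (pre-⊗ l (θ c p) q)))
              (≋-trans (·-⊗ c (pre l (∂₁ p)) q) (·-cong c (≋-sym (pre-⊗ l (∂₁ p) q)))) ⟩
  pre l (z ⊗ (p ⊗ q)) ⊕ pre l (θ c p ⊗ q) ⊕ c · pre l (∂₁ p ⊗ q) ∎
  where open ≋-Reasoning

H-pre-⊗ : ∀ l p q → H (pre l p) ⊗ q ≋ pre l (p ⊗ q) ⊕ pre l (H p ⊗ q)
H-pre-⊗ l p q = ≋-trans (⊗-congʳ q (H-pre l p))
  (≋-trans (⊗-distribʳ-⊕ (pre l p) (pre l (H p)) q) (≋-sym (⊕-cong (pre-⊗ l p q) (pre-⊗ l (H p) q))))

θ-mon-⊗ : ∀ c u q → θ c (mon u ⊗ q) ≋ θ c (mon u) ⊗ q ⊕ mon u ⊗ θ c q ⊕ c · (H (mon u) ⊗ ∂₁ q)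
θ-mon-⊗ c [] q = begin
  θ c (mon [] ⊗ q)                                  ≋⟨ linear-cong (θ-linear c) (⊗-identityˡ q) ⟩
  θ c q                                             ≋⟨ ⊗-identityˡ (θ c q) ⟨
  mon [] ⊗ θ c q                                    ≋⟨ ⊕-identityʳ (mon [] ⊗ θ c q) ⟨
  mon [] ⊗ θ c q ⊕ 0P                               ≋⟨ ⊕-congˡ (mon [] ⊗ θ c q) (·-cong c (⊗-zeroˡ H-empty (∂₁ q))) ⟨
  mon [] ⊗ θ c q ⊕ c · (H (mon []) ⊗ ∂₁ q)          ∎
  where open ≋-Reasoning
θ-mon-⊗ c (l ∷ u) q = begin
  θ c (pre l U ⊗ q)                                 ≋⟨ linear-cong (θ-linear c) (pre-⊗ l U q) ⟨
  θ c (pre l (U ⊗ q))                               ≋⟨ θ-pre c l (U ⊗ q) ⟩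
  pre l A ⊕ pre l (θ c (U ⊗ q)) ⊕ c · pre l (∂₁ (U ⊗ q))
    ≋⟨ ⊕-cong (⊕-congˡ (pre l A) (pre-cong l (θ-mon-⊗ c u q))) (·-cong c (pre-cong l (∂₁-⊗ U q))) ⟩
  pre l A ⊕ pre l (B ⊕ C ⊕ c · D) ⊕ c · pre l (E ⊕ F)
    ≋⟨ solveWith c l 6 (λ a b d e f g →
         l◃ a ⊞ l◃ (b ⊞ d ⊞ c⊡ e) ⊞ c⊡ l◃ (f ⊞ g) ⊜ l◃ a ⊞ l◃ b ⊞ c⊡ l◃ f ⊞ l◃ d ⊞ c⊡ (l◃ g ⊞ l◃ e))
         refl A B C D E F ⟩
  (pre l A ⊕ pre l B ⊕ c · pre l E) ⊕ pre l C ⊕ c · (pre l F ⊕ pre l D)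
    ≋⟨ ⊕-cong (⊕-cong (θ-pre-⊗ c l U q) (≋-sym (pre-⊗ l U (θ c q)))) (·-cong c (H-pre-⊗ l U (∂₁ q))) ⟨
  θ c (pre l U) ⊗ q ⊕ pre l U ⊗ θ c q ⊕ c · (H (pre l U) ⊗ ∂₁ q) ∎
  where
  open ≋-Reasoning
  U A B C D E F : Poly
  U = mon u
  A = z ⊗ (U ⊗ q)
  B = θ c U ⊗ q
  C = U ⊗ θ c q
  D = H U ⊗ ∂₁ q
  E = ∂₁ U ⊗ q
  F = U ⊗ ∂₁ q

θ-⊗ : ∀ c p q → θ c (p ⊗ q) ≋ θ c p ⊗ q ⊕ p ⊗ θ c q ⊕ c · (H p ⊗ ∂₁ q)
θ-⊗ c p q = linear-ext (∘-linear (θ-linear c) (⊗ˡ-linear q))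
  (⊕-linear (⊕-linear (∘-linear (⊗ˡ-linear q) (θ-linear c)) (⊗ˡ-linear (θ c q)))
            (·-linear c (∘-linear (⊗ˡ-linear (∂₁ q)) H-linear)))
  (λ u → θ-mon-⊗ c u q) p

∂₁-x : ∂₁ x ≋ y ⊗ x
∂₁-x = compute refl

∂₁-z : ∂₁ z ≋ 0P
∂₁-z = compute refl

θ-x : ∀ c → θ c x ≋ x ⊗ z
θ-x c = compute refl

θ-z : ∀ c → θ c z ≋ z ⊗ z
θ-z c = compute refl

θ-⊗x : ∀ c p → θ c (p ⊗ x) ≋ θ̃ c p ⊗ x ⊕ (p ⊗ x) ⊗ z
θ-⊗x c p = begin
  θ c (p ⊗ x)                                          ≋⟨ θ-⊗ c p x ⟩
  θ c p ⊗ x ⊕ p ⊗ θ c x ⊕ c · (H p ⊗ ∂₁ x)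
    ≋⟨ ⊕-cong (⊕-congˡ (θ c p ⊗ x) (≋-trans (⊗-congˡ p (θ-x c)) (≋-sym (⊗-assoc p x z))))
              (·-cong c (≋-trans (⊗-congˡ (H p) ∂₁-x) (≋-sym (⊗-assoc (H p) y x)))) ⟩
  θ c p ⊗ x ⊕ (p ⊗ x) ⊗ z ⊕ c · ((H p ⊗ y) ⊗ x)
    ≋⟨ solveWith c X 3 (λ a b d → a ⊞ b ⊞ c⊡ d ⊜ a ⊞ c⊡ d ⊞ b) refl (θ c p ⊗ x) ((p ⊗ x) ⊗ z) ((H p ⊗ y) ⊗ x) ⟩
  θ c p ⊗ x ⊕ c · ((H p ⊗ y) ⊗ x) ⊕ (p ⊗ x) ⊗ z
    ≋⟨ ⊕-congʳ ((p ⊗ x) ⊗ z) (≋-trans (⊗-distribʳ-⊕ (θ c p) (c · (H p ⊗ y)) x) (⊕-congˡ (θ c p ⊗ x) (·-⊗ c (H p ⊗ y) x))) ⟨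
  θ̃ c p ⊗ x ⊕ (p ⊗ x) ⊗ z                              ∎
  where open ≋-Reasoning

θ-⊗z : ∀ c p → θ c (p ⊗ z) ≋ θ c p ⊗ z ⊕ (p ⊗ z) ⊗ z
θ-⊗z c p = begin
  θ c (p ⊗ z)                                          ≋⟨ θ-⊗ c p z ⟩
  θ c p ⊗ z ⊕ p ⊗ θ c z ⊕ c · (H p ⊗ ∂₁ z)
    ≋⟨ ⊕-cong (⊕-congˡ (θ c p ⊗ z) (≋-trans (⊗-congˡ p (θ-z c)) (≋-sym (⊗-assoc p z z))))
              (·-cong c (⊗-zeroʳ (H p) ∂₁-z)) ⟩
  θ c p ⊗ z ⊕ (p ⊗ z) ⊗ z ⊕ 0P                         ≋⟨ ⊕-identityʳ (θ c p ⊗ z ⊕ (p ⊗ z) ⊗ z) ⟩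
  θ c p ⊗ z ⊕ (p ⊗ z) ⊗ z                              ∎
  where open ≋-Reasoning

harmonic-induction : (P : Word → Word → Set) →
  (∀ v → P [] v) →
  (∀ u v → P u v → P (X ∷ u) v) →
  (∀ u → P (Y ∷ u) []) →
  (∀ u v → P (Y ∷ u) v → P (Y ∷ u) (X ∷ v)) →
  (∀ u v → P u (Y ∷ v) → P (Y ∷ u) v → P u v → P (Y ∷ u) (Y ∷ v)) →
  ∀ u v → P u v
harmonic-induction P nil xl ynil yx yy = go
  where
  go : ∀ u v → P u v
  go [] v = nil v
  go (X ∷ u) v = xl u v (go u v)
  go (Y ∷ u) [] = ynil u
  go (Y ∷ u) (X ∷ v) = yx u v (go (Y ∷ u) v)
  go (Y ∷ u) (Y ∷ v) = yy u v (go u (Y ∷ v)) (go (Y ∷ u) v) (go u v)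

*W-[] : ∀ u → u *W [] ≋ mon u
*W-[] [] = ≋-refl
*W-[] (X ∷ u) = pre-cong X (*W-[] u)
*W-[] (Y ∷ u) = ≋-refl

*W-X : ∀ u v → u *W (X ∷ v) ≋ pre X (u *W v)
*W-X [] v = ≋-refl
*W-X (X ∷ u) v = pre-cong X (*W-X u v)
*W-X (Y ∷ u) v = ≋-refl

*W-comm : ∀ u v → u *W v ≋ v *W u
*W-comm = harmonic-induction (λ u v → u *W v ≋ v *W u)
  (λ v → ≋-sym (*W-[] v))
  (λ u v ih → ≋-trans (pre-cong X ih) (≋-sym (*W-X v u)))
  (λ u → ≋-refl)
  (λ u v ih → pre-cong X ih)
  (λ u v ih₁ ih₂ ih₃ → ≋-trans
     (⊕-cong (⊕-cong (pre-cong Y ih₁) (pre-cong Y ih₂)) (pre-cong Y (pre-cong X ih₃)))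
     (solve 3 (λ a b d → Y ◃ a ⊞ Y ◃ b ⊞ Y ◃ X ◃ d ⊜ Y ◃ b ⊞ Y ◃ a ⊞ Y ◃ X ◃ d) refl
        ((Y ∷ v) *W u) (v *W (Y ∷ u)) (v *W u)))

⋆-comm : ∀ p q → p ⋆ q ≋ q ⋆ p
⋆-comm = bilinear-ext _⋆_ (λ p q → q ⋆ p) ⋆ˡ-linear ⋆ʳ-linear ⋆ʳ-linear ⋆ˡ-linear λ u v →
  ≋-trans (mon-⋆ u v) (≋-trans (*W-comm u v) (≋-sym (mon-⋆ v u)))

⋆-Xˡ : ∀ p q → pre X p ⋆ q ≋ pre X (p ⋆ q)
⋆-Xˡ = bilinear-ext (λ p q → pre X p ⋆ q) (λ p q → pre X (p ⋆ q))
  (λ q → ∘-linear (⋆ˡ-linear q) (pre-linear X)) (λ p → ⋆ʳ-linear (pre X p))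
  (λ q → ∘-linear (pre-linear X) (⋆ˡ-linear q)) (λ p → ∘-linear (pre-linear X) (⋆ʳ-linear p))
  λ u v → ≋-trans (mon-⋆ (X ∷ u) v) (≋-sym (pre-cong X (mon-⋆ u v)))

⋆-Xʳ : ∀ p q → p ⋆ pre X q ≋ pre X (p ⋆ q)
⋆-Xʳ p q = ≋-trans (⋆-comm p (pre X q)) (≋-trans (⋆-Xˡ q p) (pre-cong X (⋆-comm q p)))

⋆-YY : ∀ p q → pre Y p ⋆ pre Y q ≋ pre Y (p ⋆ pre Y q) ⊕ pre Y (pre Y p ⋆ q) ⊕ pre Y (pre X (p ⋆ q))
⋆-YY = bilinear-ext (λ p q → pre Y p ⋆ pre Y q)
  (λ p q → pre Y (p ⋆ pre Y q) ⊕ pre Y (pre Y p ⋆ q) ⊕ pre Y (pre X (p ⋆ q)))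
  (λ q → ∘-linear (⋆ˡ-linear (pre Y q)) (pre-linear Y))
  (λ p → ∘-linear (⋆ʳ-linear (pre Y p)) (pre-linear Y))
  (λ q → ⊕-linear (⊕-linear (∘-linear (pre-linear Y) (⋆ˡ-linear (pre Y q)))
                            (∘-linear (pre-linear Y) (∘-linear (⋆ˡ-linear q) (pre-linear Y))))
                  (∘-linear (pre-linear Y) (∘-linear (pre-linear X) (⋆ˡ-linear q))))
  (λ p → ⊕-linear (⊕-linear (∘-linear (pre-linear Y) (∘-linear (⋆ʳ-linear p) (pre-linear Y)))
                            (∘-linear (pre-linear Y) (⋆ʳ-linear (pre Y p))))
                  (∘-linear (pre-linear Y) (∘-linear (pre-linear X) (⋆ʳ-linear p))))
  λ u v → ≋-trans (mon-⋆ (Y ∷ u) (Y ∷ v)) (≋-sym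
    (⊕-cong (⊕-cong (pre-cong Y (mon-⋆ u (Y ∷ v))) (pre-cong Y (mon-⋆ (Y ∷ u) v)))
            (pre-cong Y (pre-cong X (mon-⋆ u v)))))

⋆-identityʳ : ∀ p → p ⋆ mon [] ≋ p
⋆-identityʳ = linear-ext (⋆ˡ-linear (mon [])) id-linear λ u → ≋-trans (mon-⋆ u []) (*W-[] u)

⋆-identityˡ : ∀ p → mon [] ⋆ p ≋ p
⋆-identityˡ p = ≋-trans (⋆-comm (mon []) p) (⋆-identityʳ p)

⋆-distribʳ-⊕ : ∀ p q r → (p ⊕ q) ⋆ r ≋ p ⋆ r ⊕ q ⋆ r
⋆-distribʳ-⊕ p q r = linear-⊕ (⋆ˡ-linear r) p q

⋆-distribˡ-⊕ : ∀ p q r → p ⋆ (q ⊕ r) ≋ p ⋆ q ⊕ p ⋆ r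
⋆-distribˡ-⊕ p = linear-⊕ (⋆ʳ-linear p)

⋆-zeroʳ : ∀ p → p ⋆ 0P ≋ 0P
⋆-zeroʳ p = linear-0 (⋆ʳ-linear p)

Y⋆y : ∀ p → pre Y p ⋆ y ≋ pre Y (p ⋆ y) ⊕ pre Y (pre Y p) ⊕ pre Y (pre X p)
Y⋆y p = ≋-trans (⋆-YY p (mon []))
  (⊕-cong (⊕-congˡ (pre Y (p ⋆ y)) (pre-cong Y (⋆-identityʳ (pre Y p)))) (pre-cong Y (pre-cong X (⋆-identityʳ p))))

⋆-y-swap-YY : ∀ p q →
  (p ⋆ pre Y q) ⋆ y ≋ (p ⋆ y) ⋆ pre Y q →
  (pre Y p ⋆ q) ⋆ y ≋ (pre Y p ⋆ y) ⋆ q →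
  (p ⋆ q) ⋆ y ≋ (p ⋆ y) ⋆ q →
  (pre Y p ⋆ pre Y q) ⋆ y ≋ (pre Y p ⋆ y) ⋆ pre Y q
⋆-y-swap-YY p q ih₁ ih₂ ih₃ = ≋-trans lhs (≋-trans
  (solve 8 (λ k₁ k₂ p₁ p₂ p₃ g₁ g₂ g₃ →
     Y ◃ k₁ ⊞ Y ◃ Y ◃ p₁ ⊞ Y ◃ X ◃ p₁ ⊞ (Y ◃ (g₁ ⊞ g₂ ⊞ g₃) ⊞ Y ◃ Y ◃ p₂ ⊞ Y ◃ X ◃ p₂)
       ⊞ (Y ◃ X ◃ k₂ ⊞ Y ◃ Y ◃ X ◃ p₃ ⊞ Y ◃ X ◃ X ◃ p₃)
     ⊜ (Y ◃ k₁ ⊞ Y ◃ g₁ ⊞ Y ◃ X ◃ k₂) ⊞ (Y ◃ (Y ◃ p₁ ⊞ Y ◃ p₂ ⊞ Y ◃ X ◃ p₃) ⊞ Y ◃ g₂ ⊞ Y ◃ X ◃ p₂)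
       ⊞ (Y ◃ X ◃ p₁ ⊞ Y ◃ g₃ ⊞ Y ◃ X ◃ X ◃ p₃))
     refl K₁ K₂ P₁ P₂ P₃ G₁ G₂ G₃)
  (≋-sym rhs))
  where
  M P₁ P₂ P₃ K₁ K₂ G₁ G₂ G₃ : Poly
  M = p ⋆ y
  P₁ = p ⋆ pre Y q
  P₂ = pre Y p ⋆ q
  P₃ = p ⋆ q
  K₁ = M ⋆ pre Y q
  K₂ = M ⋆ q
  G₁ = pre Y M ⋆ q
  G₂ = pre Y (pre Y p) ⋆ q
  G₃ = pre Y (pre X p) ⋆ q
  y-split : (pre Y p ⋆ y) ⋆ q ≋ G₁ ⊕ G₂ ⊕ G₃
  y-split = ≋-trans (⋆-congʳ q (Y⋆y p)) (linear-⊕₃ (⋆ˡ-linear q) (pre Y M) (pre Y (pre Y p)) (pre Y (pre X p)))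
  lhs : (pre Y p ⋆ pre Y q) ⋆ y ≋
        pre Y K₁ ⊕ pre Y (pre Y P₁) ⊕ pre Y (pre X P₁) ⊕ (pre Y (G₁ ⊕ G₂ ⊕ G₃) ⊕ pre Y (pre Y P₂) ⊕ pre Y (pre X P₂))
          ⊕ (pre Y (pre X K₂) ⊕ pre Y (pre Y (pre X P₃)) ⊕ pre Y (pre X (pre X P₃)))
  lhs = ≋-trans (⋆-congʳ y (⋆-YY p q)) (≋-trans (linear-⊕₃ (⋆ˡ-linear y) (pre Y P₁) (pre Y P₂) (pre Y (pre X P₃)))
    (⊕-cong (⊕-cong (≋-trans (Y⋆y P₁) (⊕-congʳ _ (⊕-congʳ _ (pre-cong Y ih₁))))
                    (≋-trans (Y⋆y P₂) (⊕-congʳ _ (⊕-congʳ _ (pre-cong Y (≋-trans ih₂ y-split))))))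
            (≋-trans (Y⋆y (pre X P₃)) (⊕-congʳ _ (⊕-congʳ _ (pre-cong Y (≋-trans (⋆-Xˡ P₃ y) (pre-cong X ih₃))))))))
  rhs : (pre Y p ⋆ y) ⋆ pre Y q ≋
        (pre Y K₁ ⊕ pre Y G₁ ⊕ pre Y (pre X K₂))
          ⊕ (pre Y (pre Y P₁ ⊕ pre Y P₂ ⊕ pre Y (pre X P₃)) ⊕ pre Y G₂ ⊕ pre Y (pre X P₂))
          ⊕ (pre Y (pre X P₁) ⊕ pre Y G₃ ⊕ pre Y (pre X (pre X P₃)))
  rhs = ≋-trans (⋆-congʳ (pre Y q) (Y⋆y p)) (≋-trans (linear-⊕₃ (⋆ˡ-linear (pre Y q)) (pre Y M) (pre Y (pre Y p)) (pre Y (pre X p)))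
    (⊕-cong (⊕-cong (⋆-YY M q)
                    (≋-trans (⋆-YY (pre Y p) q) (⊕-congʳ _ (⊕-congʳ _ (pre-cong Y (⋆-YY p q))))))
            (≋-trans (⋆-YY (pre X p) q)
                     (⊕-cong (⊕-congʳ _ (pre-cong Y (⋆-Xˡ p (pre Y q)))) (pre-cong Y (pre-cong X (⋆-Xˡ p q)))))))

⋆-y-swap : ∀ p q → (p ⋆ q) ⋆ y ≋ (p ⋆ y) ⋆ q
⋆-y-swap = bilinear-ext (λ p q → (p ⋆ q) ⋆ y) (λ p q → (p ⋆ y) ⋆ q)
  (λ q → ∘-linear (⋆ˡ-linear y) (⋆ˡ-linear q)) (λ p → ∘-linear (⋆ˡ-linear y) (⋆ʳ-linear p))
  (λ q → ∘-linear (⋆ˡ-linear q) (⋆ˡ-linear y)) (λ p → ⋆ʳ-linear (p ⋆ y))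
  (harmonic-induction (λ u v → (mon u ⋆ mon v) ⋆ y ≋ (mon u ⋆ y) ⋆ mon v)
    (λ v → ≋-trans (⋆-congʳ y (⋆-identityˡ (mon v)))
             (≋-trans (⋆-comm (mon v) y) (≋-sym (⋆-congʳ (mon v) (⋆-identityˡ y)))))
    (λ u v ih → ≋-trans (⋆-congʳ y (⋆-Xˡ (mon u) (mon v)))
      (≋-trans (⋆-Xˡ (mon u ⋆ mon v) y) (≋-trans (pre-cong X ih)
        (≋-sym (≋-trans (⋆-congʳ (mon v) (⋆-Xˡ (mon u) y)) (⋆-Xˡ (mon u ⋆ y) (mon v)))))))
    (λ u → ≋-trans (⋆-congʳ y (⋆-identityʳ (mon (Y ∷ u)))) (≋-sym (⋆-identityʳ (mon (Y ∷ u) ⋆ y))))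
    (λ u v ih → ≋-trans (⋆-congʳ y (⋆-Xʳ (mon (Y ∷ u)) (mon v)))
      (≋-trans (⋆-Xˡ (mon (Y ∷ u) ⋆ mon v) y) (≋-trans (pre-cong X ih)
        (≋-sym (⋆-Xʳ (mon (Y ∷ u) ⋆ y) (mon v))))))
    (λ u v → ⋆-y-swap-YY (mon u) (mon v)))

δL : Letter → Poly
δL X = 0P
δL Y = (- 1ℚ) · (y ⊗ z)

δW : Word → Poly
δW [] = 0P
δW (l ∷ u) = δL l ⊗ mon u ⊕ pre l (δW u)

δ : Poly → Poly
δ = lin δW

δ-linear : Linear δ
δ-linear = lin-linear δW

*W-y : ∀ u → u *W (Y ∷ []) ≋ mon u ⊗ y ⊖ δW u
*W-y [] = compute refl
*W-y (X ∷ u) = ≋-trans (pre-cong X (*W-y u)) (≋-trans (pre-⊕ X (mon u ⊗ y) ((- 1ℚ) · δW u))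
  (⊕-cong (pre-⊗ X (mon u) y) (pre-· X (- 1ℚ) (δW u))))
*W-y (Y ∷ u) = begin
  pre Y (u *W (Y ∷ [])) ⊕ pre Y (pre Y U) ⊕ pre Y (pre X (u *W []))
    ≋⟨ ⊕-cong (⊕-congʳ (pre Y (pre Y U)) (pre-cong Y (*W-y u))) (pre-cong Y (pre-cong X (*W-[] u))) ⟩
  pre Y (U ⊗ y ⊖ δW u) ⊕ pre Y (pre Y U) ⊕ pre Y (pre X U)
    ≋⟨ solve 3 (λ a d e → Y ◃ (a ⊟ d) ⊞ Y ◃ Y ◃ e ⊞ Y ◃ X ◃ e ⊜ Y ◃ a ⊟ ((- 1ℚ) ⊡ (Y ◃ X ◃ e ⊞ Y ◃ Y ◃ e) ⊞ Y ◃ d))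
         refl (U ⊗ y) (δW u) U ⟩
  pre Y (U ⊗ y) ⊖ ((- 1ℚ) · (pre Y (pre X U) ⊕ pre Y (pre Y U)) ⊕ pre Y (δW u))
    ≋⟨ ⊖-cong (≋-sym (pre-⊗ Y U y)) (⊕-congʳ (pre Y (δW u)) (≋-trans (·-⊗ (- 1ℚ) (y ⊗ z) U) (·-cong (- 1ℚ) yz⊗U))) ⟨
  pre Y U ⊗ y ⊖ (δL Y ⊗ U ⊕ pre Y (δW u)) ∎
  where
  open ≋-Reasoning
  U : Poly
  U = mon u
  yz⊗U : (y ⊗ z) ⊗ U ≋ pre Y (pre X U) ⊕ pre Y (pre Y U)
  yz⊗U = ≋-trans (⊗-assoc y z U) (≋-trans (letter-⊗ Y (z ⊗ U))
    (≋-trans (pre-cong Y (≋-trans (⊗-distribʳ-⊕ x y U) (⊕-cong (letter-⊗ X U) (letter-⊗ Y U)))) (pre-⊕ Y (pre X U) (pre Y U))))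

⋆-y : ∀ p → p ⋆ y ≋ p ⊗ y ⊖ δ p
⋆-y = linear-ext (⋆ˡ-linear y) (⊖-linear (⊗ˡ-linear y) δ-linear) λ u →
  ≋-trans (mon-⋆ u (Y ∷ [])) (≋-trans (*W-y u) (⊖-cong ≋-refl (≋-sym (lin-mon δW u))))

-- spread S (a₁ ⋯ aₙ) = Σᵢ a₁ ⋯ aᵢ S(aᵢ₊₁ ⋯ aₙ)
spreadW : (Poly → Poly) → Word → Poly
spreadW S [] = 0P
spreadW S (l ∷ u) = pre l (spreadW S u) ⊕ pre l (S (mon u))

spread : (Poly → Poly) → Poly → Poly
spread S = lin (spreadW S)

spread-linear : ∀ S → Linear (spread S)
spread-linear S = lin-linear (spreadW S)

spread-pre : ∀ {S} → Linear S → ∀ l p → spread S (pre l p) ≋ pre l (spread S p) ⊕ pre l (S p)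
spread-pre {S} LS l = lin-pre (spreadW S) l
  (⊕-linear (∘-linear (pre-linear l) (spread-linear S)) (∘-linear (pre-linear l) LS)) λ u →
  ⊕-congʳ (pre l (S (mon u))) (pre-cong l (≋-sym (lin-mon (spreadW S) u)))

module _ {S : Poly → Poly} (S-linear : Linear S)
         (S-⋆ : ∀ p q → S (p ⋆ q) ≋ S p ⋆ q)
         (S-X : ∀ p → S (pre X p) ≋ pre X (S p)) where

  private
    T : Poly → Poly
    T = spread S
    T-linear : Linear T
    T-linear = spread-linear S
    T-pre : ∀ l p → T (pre l p) ≋ pre l (T p) ⊕ pre l (S p)
    T-pre = spread-pre S-linear

  S-⋆ʳ : ∀ p q → S (p ⋆ q) ≋ p ⋆ S q
  S-⋆ʳ p q = ≋-trans (linear-cong S-linear (⋆-comm p q)) (≋-trans (S-⋆ q p) (⋆-comm (S q) p))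

  spread-⋆-YY : ∀ p q →
    T (p ⋆ pre Y q) ≋ T p ⋆ pre Y q ⊕ p ⋆ T (pre Y q) →
    T (pre Y p ⋆ q) ≋ T (pre Y p) ⋆ q ⊕ pre Y p ⋆ T q →
    T (p ⋆ q) ≋ T p ⋆ q ⊕ p ⋆ T q →
    T (pre Y p ⋆ pre Y q) ≋ T (pre Y p) ⋆ pre Y q ⊕ pre Y p ⋆ T (pre Y q)
  spread-⋆-YY p q ih₁ ih₂ ih₃ = ≋-trans lhs (≋-trans
    (solve 12 (λ a₁ a₂ a₃ a₄ a₅ a₆ a₇ a₈ g₁ g₂ j₁ j₂ →
       Y ◃ (a₁ ⊞ (j₁ ⊞ j₂)) ⊞ Y ◃ a₂ ⊞ (Y ◃ (g₁ ⊞ g₂ ⊞ a₃) ⊞ Y ◃ a₄)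
         ⊞ (Y ◃ (X ◃ (a₅ ⊞ a₆) ⊞ X ◃ a₇) ⊞ Y ◃ X ◃ a₈)
       ⊜ (Y ◃ a₁ ⊞ Y ◃ g₁ ⊞ Y ◃ X ◃ a₅ ⊞ (Y ◃ a₂ ⊞ Y ◃ g₂ ⊞ Y ◃ X ◃ a₇))
         ⊞ (Y ◃ j₁ ⊞ Y ◃ a₃ ⊞ Y ◃ X ◃ a₆ ⊞ (Y ◃ j₂ ⊞ Y ◃ a₄ ⊞ Y ◃ X ◃ a₈)))
       refl A₁ A₂ A₃ A₄ A₅ A₆ A₇ A₈ G₁ G₂ J₁ J₂)
    (≋-sym rhs))
    where
    A₁ A₂ A₃ A₄ A₅ A₆ A₇ A₈ G₁ G₂ J₁ J₂ : Poly
    A₁ = T p ⋆ pre Y q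
    A₂ = S p ⋆ pre Y q
    A₃ = pre Y p ⋆ T q
    A₄ = pre Y p ⋆ S q
    A₅ = T p ⋆ q
    A₆ = p ⋆ T q
    A₇ = S p ⋆ q
    A₈ = p ⋆ S q
    G₁ = pre Y (T p) ⋆ q
    G₂ = pre Y (S p) ⋆ q
    J₁ = p ⋆ pre Y (T q)
    J₂ = p ⋆ pre Y (S q)
    lhs : T (pre Y p ⋆ pre Y q) ≋
          pre Y (A₁ ⊕ (J₁ ⊕ J₂)) ⊕ pre Y A₂ ⊕ (pre Y (G₁ ⊕ G₂ ⊕ A₃) ⊕ pre Y A₄)
            ⊕ (pre Y (pre X (A₅ ⊕ A₆) ⊕ pre X A₇) ⊕ pre Y (pre X A₈))
    lhs = ≋-trans (linear-cong T-linear (⋆-YY p q))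
      (≋-trans (linear-⊕₃ T-linear (pre Y (p ⋆ pre Y q)) (pre Y (pre Y p ⋆ q)) (pre Y (pre X (p ⋆ q))))
        (⊕-cong (⊕-cong
          (≋-trans (T-pre Y (p ⋆ pre Y q)) (⊕-cong
            (pre-cong Y (≋-trans ih₁ (⊕-congˡ A₁ (≋-trans (⋆-congˡ p (T-pre Y q)) (⋆-distribˡ-⊕ p (pre Y (T q)) (pre Y (S q)))))))
            (pre-cong Y (S-⋆ p (pre Y q)))))
          (≋-trans (T-pre Y (pre Y p ⋆ q)) (⊕-cong
            (pre-cong Y (≋-trans ih₂ (⊕-congʳ A₃ (≋-trans (⋆-congʳ q (T-pre Y p)) (⋆-distribʳ-⊕ (pre Y (T p)) (pre Y (S p)) q)))))
            (pre-cong Y (S-⋆ʳ (pre Y p) q)))))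
          (≋-trans (T-pre Y (pre X (p ⋆ q))) (⊕-cong
            (pre-cong Y (≋-trans (T-pre X (p ⋆ q)) (⊕-cong (pre-cong X ih₃) (pre-cong X (S-⋆ p q)))))
            (pre-cong Y (≋-trans (S-X (p ⋆ q)) (pre-cong X (S-⋆ʳ p q))))))))
    rhs : T (pre Y p) ⋆ pre Y q ⊕ pre Y p ⋆ T (pre Y q) ≋
          (pre Y A₁ ⊕ pre Y G₁ ⊕ pre Y (pre X A₅) ⊕ (pre Y A₂ ⊕ pre Y G₂ ⊕ pre Y (pre X A₇)))
            ⊕ (pre Y J₁ ⊕ pre Y A₃ ⊕ pre Y (pre X A₆) ⊕ (pre Y J₂ ⊕ pre Y A₄ ⊕ pre Y (pre X A₈)))
    rhs = ⊕-cong
      (≋-trans (⋆-congʳ (pre Y q) (T-pre Y p))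
        (≋-trans (⋆-distribʳ-⊕ (pre Y (T p)) (pre Y (S p)) (pre Y q)) (⊕-cong (⋆-YY (T p) q) (⋆-YY (S p) q))))
      (≋-trans (⋆-congˡ (pre Y p) (T-pre Y q))
        (≋-trans (⋆-distribˡ-⊕ (pre Y p) (pre Y (T q)) (pre Y (S q))) (⊕-cong (⋆-YY p (T q)) (⋆-YY p (S q)))))

  spread-⋆-Xˡ : ∀ p q → T (p ⋆ q) ≋ T p ⋆ q ⊕ p ⋆ T q →
    T (pre X p ⋆ q) ≋ T (pre X p) ⋆ q ⊕ pre X p ⋆ T q
  spread-⋆-Xˡ p q ih = begin
    T (pre X p ⋆ q)                                       ≋⟨ linear-cong T-linear (⋆-Xˡ p q) ⟩
    T (pre X (p ⋆ q))                                     ≋⟨ T-pre X (p ⋆ q) ⟩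
    pre X (T (p ⋆ q)) ⊕ pre X (S (p ⋆ q))                 ≋⟨ ⊕-cong (pre-cong X ih) (pre-cong X (S-⋆ p q)) ⟩
    pre X (T p ⋆ q ⊕ p ⋆ T q) ⊕ pre X (S p ⋆ q)
      ≋⟨ solve 3 (λ a b d → X ◃ (a ⊞ b) ⊞ X ◃ d ⊜ X ◃ a ⊞ X ◃ d ⊞ X ◃ b) refl (T p ⋆ q) (p ⋆ T q) (S p ⋆ q) ⟩
    pre X (T p ⋆ q) ⊕ pre X (S p ⋆ q) ⊕ pre X (p ⋆ T q)
      ≋⟨ ⊕-cong (≋-trans (⋆-congʳ q (T-pre X p))
                  (≋-trans (⋆-distribʳ-⊕ (pre X (T p)) (pre X (S p)) q) (⊕-cong (⋆-Xˡ (T p) q) (⋆-Xˡ (S p) q))))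
                (⋆-Xˡ p (T q)) ⟨
    T (pre X p) ⋆ q ⊕ pre X p ⋆ T q                       ∎
    where open ≋-Reasoning

  spread-⋆-Xʳ : ∀ p q → T (p ⋆ q) ≋ T p ⋆ q ⊕ p ⋆ T q →
    T (p ⋆ pre X q) ≋ T p ⋆ pre X q ⊕ p ⋆ T (pre X q)
  spread-⋆-Xʳ p q ih = begin
    T (p ⋆ pre X q)                                       ≋⟨ linear-cong T-linear (⋆-Xʳ p q) ⟩
    T (pre X (p ⋆ q))                                     ≋⟨ T-pre X (p ⋆ q) ⟩
    pre X (T (p ⋆ q)) ⊕ pre X (S (p ⋆ q))                 ≋⟨ ⊕-cong (pre-cong X ih) (pre-cong X (S-⋆ʳ p q)) ⟩
    pre X (T p ⋆ q ⊕ p ⋆ T q) ⊕ pre X (p ⋆ S q)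
      ≋⟨ solve 3 (λ a b d → X ◃ (a ⊞ b) ⊞ X ◃ d ⊜ X ◃ a ⊞ (X ◃ b ⊞ X ◃ d)) refl (T p ⋆ q) (p ⋆ T q) (p ⋆ S q) ⟩
    pre X (T p ⋆ q) ⊕ (pre X (p ⋆ T q) ⊕ pre X (p ⋆ S q))
      ≋⟨ ⊕-cong (⋆-Xʳ (T p) q) (≋-trans (⋆-congˡ p (T-pre X q))
           (≋-trans (⋆-distribˡ-⊕ p (pre X (T q)) (pre X (S q))) (⊕-cong (⋆-Xʳ p (T q)) (⋆-Xʳ p (S q))))) ⟨
    T p ⋆ pre X q ⊕ p ⋆ T (pre X q)                       ∎
    where open ≋-Reasoning

  spread-⋆ : ∀ p q → T (p ⋆ q) ≋ T p ⋆ q ⊕ p ⋆ T q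
  spread-⋆ = bilinear-ext (λ p q → T (p ⋆ q)) (λ p q → T p ⋆ q ⊕ p ⋆ T q)
    (λ q → ∘-linear T-linear (⋆ˡ-linear q)) (λ p → ∘-linear T-linear (⋆ʳ-linear p))
    (λ q → ⊕-linear (∘-linear (⋆ˡ-linear q) T-linear) (⋆ˡ-linear (T q)))
    (λ p → ⊕-linear (⋆ʳ-linear (T p)) (∘-linear (⋆ʳ-linear p) T-linear))
    (harmonic-induction (λ u v → T (mon u ⋆ mon v) ≋ T (mon u) ⋆ mon v ⊕ mon u ⋆ T (mon v))
      (λ v → ≋-trans (linear-cong T-linear (⋆-identityˡ (mon v))) (≋-sym (⋆-identityˡ (T (mon v)))))
      (λ u v → spread-⋆-Xˡ (mon u) (mon v))
      (λ u → ≋-trans (linear-cong T-linear (⋆-identityʳ (mon (Y ∷ u)))) (≋-sym (right-unit u)))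
      (λ u v → spread-⋆-Xʳ (mon (Y ∷ u)) (mon v))
      (λ u v → spread-⋆-YY (mon u) (mon v)))
    where
    right-unit : ∀ u → T (mon (Y ∷ u)) ⋆ mon [] ⊕ mon (Y ∷ u) ⋆ 0P ≋ T (mon (Y ∷ u))
    right-unit u = ≋-trans (⊕-congˡ (T (mon (Y ∷ u)) ⋆ mon []) (⋆-zeroʳ (mon (Y ∷ u))))
      (≋-trans (⊕-identityʳ (T (mon (Y ∷ u)) ⋆ mon [])) (⋆-identityʳ (T (mon (Y ∷ u)))))

φ-linear : Linear φ
φ-linear = lin-linear φW

φW-++ : ∀ u v → φW (u ++ v) ≋ φW u ⊗ φW v
φW-++ [] v = ≋-sym (⊗-identityˡ (φW v))
φW-++ (l ∷ u) v = ≋-trans (⊗-congˡ (φL l) (φW-++ u v)) (≋-sym (⊗-assoc (φL l) (φW u) (φW v)))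

φ-⊗ : ∀ p q → φ (p ⊗ q) ≋ φ p ⊗ φ q
φ-⊗ = bilinear-ext (λ p q → φ (p ⊗ q)) (λ p q → φ p ⊗ φ q)
  (λ q → ∘-linear φ-linear (⊗ˡ-linear q)) (λ p → ∘-linear φ-linear (⊗ʳ-linear p))
  (λ q → ∘-linear (⊗ˡ-linear (φ q)) φ-linear) (λ p → ∘-linear (⊗ʳ-linear (φ p)) φ-linear)
  λ u v → ≋-trans (lin-cong φW (mon-⊗ u v)) (≋-trans (lin-mon φW (u ++ v))
    (≋-trans (φW-++ u v) (≋-sym (⊗-cong (lin-mon φW u) (lin-mon φW v)))))

φ-pre : ∀ l p → φ (pre l p) ≋ φL l ⊗ φ p
φ-pre l p = ≋-trans (lin-cong φW (≋-sym (letter-⊗ l p)))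
  (≋-trans (φ-⊗ (mon (l ∷ [])) p) (⊗-congʳ (φ p) (≋-trans (lin-mon φW (l ∷ [])) (⊗-identityʳ (φL l)))))

φ-y : φ y ≋ (- 1ℚ) · y
φ-y = compute refl

φ-involutive : ∀ p → φ (φ p) ≋ p
φ-involutive = linear-ext (∘-linear φ-linear φ-linear) id-linear λ w →
  ≋-trans (lin-cong φW (lin-mon φW w)) (word w)
  where
  letter : ∀ l → φ (φL l) ≋ mon (l ∷ [])
  letter X = compute refl
  letter Y = compute refl
  word : ∀ w → φ (φW w) ≋ mon w
  word [] = compute refl
  word (l ∷ u) = ≋-trans (φ-⊗ (φL l) (φW u)) (≋-trans (⊗-cong (letter l) (word u)) (mon-⊗ (l ∷ []) u))

∂₁-φ : ∀ p → ∂₁ (φ p) ≋ φ (δ p)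
∂₁-φ = linear-ext (∘-linear ∂₁-linear φ-linear) (∘-linear φ-linear δ-linear) λ w →
  ≋-trans (lin-cong ∂₁W (lin-mon φW w)) (≋-trans (word w) (≋-sym (lin-cong φW (lin-mon δW w))))
  where
  letter : ∀ l → ∂₁ (φL l) ≋ φ (δL l)
  letter X = compute refl
  letter Y = compute refl
  word : ∀ w → ∂₁ (φW w) ≋ φ (δW w)
  word [] = compute refl
  word (l ∷ u) = begin
    ∂₁ (φL l ⊗ φW u)                                       ≋⟨ ∂₁-⊗ (φL l) (φW u) ⟩
    ∂₁ (φL l) ⊗ φW u ⊕ φL l ⊗ ∂₁ (φW u)                    ≋⟨ ⊕-cong (⊗-cong (letter l) (≋-sym (lin-mon φW u)))
                                                                       (⊗-congˡ (φL l) (word u)) ⟩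
    φ (δL l) ⊗ φ (mon u) ⊕ φL l ⊗ φ (δW u)                 ≋⟨ ⊕-cong (φ-⊗ (δL l) (mon u)) (φ-pre l (δW u)) ⟨
    φ (δL l ⊗ mon u) ⊕ φ (pre l (δW u))                    ≋⟨ linear-⊕ φ-linear (δL l ⊗ mon u) (pre l (δW u)) ⟨
    φ (δL l ⊗ mon u ⊕ pre l (δW u))                        ∎
    where open ≋-Reasoning

φ-⋆y : ∀ p → φ (p ⋆ y) ≋ (- 1ℚ) · (φ p ⊗ y) ⊖ φ (δ p)
φ-⋆y p = begin
  φ (p ⋆ y)                              ≋⟨ lin-cong φW (⋆-y p) ⟩
  φ (p ⊗ y ⊖ δ p)                        ≋⟨ linear-⊖ φ-linear (p ⊗ y) (δ p) ⟩
  φ (p ⊗ y) ⊖ φ (δ p)                    ≋⟨ ⊖-cong (≋-trans (φ-⊗ p y) (≋-trans (⊗-congˡ (φ p) φ-y) (⊗-· (- 1ℚ) (φ p) y))) ≋-refl ⟩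
  (- 1ℚ) · (φ p ⊗ y) ⊖ φ (δ p)           ∎
  where open ≋-Reasoning

σ : ℚ → Poly → Poly
σ c p = pre X p ⊖ c · (p ⋆ y)

θ⋆ : ℚ → Poly → Poly
θ⋆ c = spread (σ c)

σ-linear : ∀ c → Linear (σ c)
σ-linear c = ⊖-linear (pre-linear X) (·-linear c (⋆ˡ-linear y))

σ-⋆ : ∀ c p q → σ c (p ⋆ q) ≋ σ c p ⋆ q
σ-⋆ c p q = ≋-sym (begin
  (pre X p ⊖ c · (p ⋆ y)) ⋆ q             ≋⟨ linear-⊖ (⋆ˡ-linear q) (pre X p) (c · (p ⋆ y)) ⟩
  pre X p ⋆ q ⊖ (c · (p ⋆ y)) ⋆ q         ≋⟨ ⊖-cong (⋆-Xˡ p q) (linear-· (⋆ˡ-linear q) c (p ⋆ y)) ⟩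
  pre X (p ⋆ q) ⊖ c · ((p ⋆ y) ⋆ q)       ≋⟨ ⊖-cong ≋-refl (·-cong c (⋆-y-swap p q)) ⟨
  pre X (p ⋆ q) ⊖ c · ((p ⋆ q) ⋆ y)       ∎)
  where open ≋-Reasoning

σ-X : ∀ c p → σ c (pre X p) ≋ pre X (σ c p)
σ-X c p = ≋-sym (≋-trans (linear-⊖ (pre-linear X) (pre X p) (c · (p ⋆ y)))
  (⊖-cong ≋-refl (≋-trans (pre-· X c (p ⋆ y)) (·-cong c (≋-sym (⋆-Xˡ p y))))))

θ⋆-⋆ : ∀ c p q → θ⋆ c (p ⋆ q) ≋ θ⋆ c p ⋆ q ⊕ p ⋆ θ⋆ c q
θ⋆-⋆ c = spread-⋆ (σ-linear c) (σ-⋆ c) (σ-X c)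

φ-σ : ∀ c p → φ (σ c p) ≋ z ⊗ φ p ⊕ c · (φ p ⊗ y) ⊕ c · φ (δ p)
φ-σ c p = begin
  φ (pre X p ⊖ c · (p ⋆ y))                         ≋⟨ linear-⊖ φ-linear (pre X p) (c · (p ⋆ y)) ⟩
  φ (pre X p) ⊖ φ (c · (p ⋆ y))                     ≋⟨ ⊖-cong (φ-pre X p) (≋-trans (linear-· φ-linear c (p ⋆ y)) (·-cong c (φ-⋆y p))) ⟩
  z ⊗ φ p ⊖ c · ((- 1ℚ) · (φ p ⊗ y) ⊖ φ (δ p))
    ≋⟨ solveWith c X 3 (λ a b d → a ⊟ c⊡ ((- 1ℚ) ⊡ b ⊟ d) ⊜ a ⊞ c⊡ b ⊞ c⊡ d) refl (z ⊗ φ p) (φ p ⊗ y) (φ (δ p)) ⟩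
  z ⊗ φ p ⊕ c · (φ p ⊗ y) ⊕ c · φ (δ p)             ∎
  where open ≋-Reasoning

θ̃-pre : ∀ c l p → θ̃ c (pre l p) ≋ pre l (z ⊗ p) ⊕ pre l (θ̃ c p) ⊕ c · pre l (∂₁ p) ⊕ c · pre l (p ⊗ y)
θ̃-pre c l p = begin
  θ c (pre l p) ⊕ c · (H (pre l p) ⊗ y)
    ≋⟨ ⊕-cong (θ-pre c l p) (·-cong c (≋-trans (⊗-congʳ y (H-pre l p))
         (≋-trans (⊗-distribʳ-⊕ (pre l p) (pre l (H p)) y) (⊕-cong (≋-sym (pre-⊗ l p y)) (≋-sym (pre-⊗ l (H p) y)))))) ⟩
  pre l (z ⊗ p) ⊕ pre l (θ c p) ⊕ c · pre l (∂₁ p) ⊕ c · (pre l (p ⊗ y) ⊕ pre l (H p ⊗ y))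
    ≋⟨ solveWith c l 5 (λ a b d e f → l◃ a ⊞ l◃ b ⊞ c⊡ l◃ d ⊞ c⊡ (l◃ e ⊞ l◃ f) ⊜ l◃ a ⊞ l◃ (b ⊞ c⊡ f) ⊞ c⊡ l◃ d ⊞ c⊡ l◃ e)
         refl (z ⊗ p) (θ c p) (∂₁ p) (p ⊗ y) (H p ⊗ y) ⟩
  pre l (z ⊗ p) ⊕ pre l (θ̃ c p) ⊕ c · pre l (∂₁ p) ⊕ c · pre l (p ⊗ y) ∎
  where open ≋-Reasoning

-- Both sides are linear in the left factor φL l, a combination of letters, so single letters suffice.
θ̃-φL⊗ : ∀ c l U →
  θ̃ c (φL l ⊗ U) ≋ φL l ⊗ (z ⊗ U) ⊕ φL l ⊗ θ̃ c U ⊕ c · (φL l ⊗ ∂₁ U) ⊕ c · (φL l ⊗ (U ⊗ y))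
θ̃-φL⊗ c l U = on-φL l
  where
  G K : Poly → Poly
  G a = θ̃ c (a ⊗ U)
  K a = a ⊗ (z ⊗ U) ⊕ a ⊗ θ̃ c U ⊕ c · (a ⊗ ∂₁ U) ⊕ c · (a ⊗ (U ⊗ y))
  G-linear : Linear G
  G-linear = ∘-linear (θ̃-linear c) (⊗ˡ-linear U)
  K-linear : Linear K
  K-linear = ⊕-linear (⊕-linear (⊕-linear (⊗ˡ-linear (z ⊗ U)) (⊗ˡ-linear (θ̃ c U)))
    (·-linear c (⊗ˡ-linear (∂₁ U)))) (·-linear c (⊗ˡ-linear (U ⊗ y)))
  on-letter : ∀ l → G (mon (l ∷ [])) ≋ K (mon (l ∷ []))
  on-letter l = ≋-trans (linear-cong (θ̃-linear c) (letter-⊗ l U)) (≋-trans (θ̃-pre c l U) (≋-sym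
    (⊕-cong (⊕-cong (⊕-cong (letter-⊗ l (z ⊗ U)) (letter-⊗ l (θ̃ c U))) (·-cong c (letter-⊗ l (∂₁ U))))
            (·-cong c (letter-⊗ l (U ⊗ y))))))
  on-φL : ∀ l → G (φL l) ≋ K (φL l)
  on-φL X = ≋-trans (linear-⊕ G-linear x y) (≋-trans (⊕-cong (on-letter X) (on-letter Y)) (≋-sym (linear-⊕ K-linear x y)))
  on-φL Y = ≋-trans (linear-· G-linear (- 1ℚ) y) (≋-trans (·-cong (- 1ℚ) (on-letter Y)) (≋-sym (linear-· K-linear (- 1ℚ) y)))

θ̃-empty : ∀ c → θ̃ c (mon []) ≋ 0P
θ̃-empty c = ⊕-congˡ (θ c (mon [])) (·-cong c (⊗-zeroˡ H-empty y))

θ̃-φ : ∀ c p → θ̃ c (φ p) ≋ φ (θ⋆ c p)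
θ̃-φ c = linear-ext (∘-linear (θ̃-linear c) φ-linear) (∘-linear φ-linear (spread-linear (σ c))) λ w →
  ≋-trans (linear-cong (θ̃-linear c) (lin-mon φW w)) (≋-trans (word w) (≋-sym (lin-cong φW (lin-mon (spreadW (σ c)) w))))
  where
  open ≋-Reasoning
  word : ∀ w → θ̃ c (φW w) ≋ φ (spreadW (σ c) w)
  word [] = θ̃-empty c
  word (l ∷ u) = begin
    θ̃ c (φL l ⊗ φW u)                                     ≋⟨ linear-cong (θ̃-linear c) (⊗-congˡ a (lin-mon φW u)) ⟨
    θ̃ c (a ⊗ V)                                           ≋⟨ θ̃-φL⊗ c l V ⟩
    a ⊗ (z ⊗ V) ⊕ a ⊗ θ̃ c V ⊕ c · (a ⊗ ∂₁ V) ⊕ c · (a ⊗ (V ⊗ y))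
      ≋⟨ ⊕-congʳ (c · (a ⊗ (V ⊗ y))) (⊕-cong (⊕-congˡ (a ⊗ (z ⊗ V))
           (⊗-congˡ a (≋-trans (linear-cong (θ̃-linear c) (lin-mon φW u)) (word u))))
           (·-cong c (⊗-congˡ a (∂₁-φ U)))) ⟩
    a ⊗ (z ⊗ V) ⊕ a ⊗ φ (spreadW (σ c) u) ⊕ c · (a ⊗ φ (δ U)) ⊕ c · (a ⊗ (V ⊗ y))
      ≋⟨ solveWith c l 4 (λ e₁ e₂ e₃ e₄ → e₁ ⊞ e₂ ⊞ c⊡ e₃ ⊞ c⊡ e₄ ⊜ e₂ ⊞ (e₁ ⊞ c⊡ e₄ ⊞ c⊡ e₃))
           refl (a ⊗ (z ⊗ V)) (a ⊗ φ (spreadW (σ c) u)) (a ⊗ φ (δ U)) (a ⊗ (V ⊗ y)) ⟩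
    a ⊗ φ (spreadW (σ c) u) ⊕ (a ⊗ (z ⊗ V) ⊕ c · (a ⊗ (V ⊗ y)) ⊕ c · (a ⊗ φ (δ U)))
      ≋⟨ ⊕-cong (φ-pre l (spreadW (σ c) u)) (≋-trans (φ-pre l (σ c U)) (≋-trans (⊗-congˡ a (φ-σ c U))
           (≋-trans (linear-⊕₃ (⊗ʳ-linear a) (z ⊗ V) (c · (V ⊗ y)) (c · φ (δ U)))
             (⊕-cong (⊕-congˡ (a ⊗ (z ⊗ V)) (⊗-· c a (V ⊗ y))) (⊗-· c a (φ (δ U))))))) ⟨
    φ (pre l (spreadW (σ c) u)) ⊕ φ (pre l (σ c U))        ≋⟨ linear-⊕ φ-linear (pre l (spreadW (σ c) u)) (pre l (σ c U)) ⟨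
    φ (spreadW (σ c) (l ∷ u))                              ∎
    where
    a U V : Poly
    a = φL l
    U = mon u
    V = φ U

θ⋆-φ : ∀ c p → θ⋆ c (φ p) ≋ φ (θ̃ c p)
θ⋆-φ c p = begin
  θ⋆ c (φ p)              ≋⟨ φ-involutive (θ⋆ c (φ p)) ⟨
  φ (φ (θ⋆ c (φ p)))      ≋⟨ lin-cong φW (θ̃-φ c (φ p)) ⟨
  φ (θ̃ c (φ (φ p)))       ≋⟨ lin-cong φW (linear-cong (θ̃-linear c) (φ-involutive p)) ⟩
  φ (θ̃ c p)               ∎
  where open ≋-Reasoning

θ̃-◇ : ∀ c p q → θ̃ c (p ◇ q) ≋ θ̃ c p ◇ q ⊕ p ◇ θ̃ c q
θ̃-◇ c p q = begin
  θ̃ c (φ (φ p ⋆ φ q))                            ≋⟨ θ̃-φ c (φ p ⋆ φ q) ⟩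
  φ (θ⋆ c (φ p ⋆ φ q))                           ≋⟨ lin-cong φW (θ⋆-⋆ c (φ p) (φ q)) ⟩
  φ (θ⋆ c (φ p) ⋆ φ q ⊕ φ p ⋆ θ⋆ c (φ q))        ≋⟨ linear-⊕ φ-linear (θ⋆ c (φ p) ⋆ φ q) (φ p ⋆ θ⋆ c (φ q)) ⟩
  φ (θ⋆ c (φ p) ⋆ φ q) ⊕ φ (φ p ⋆ θ⋆ c (φ q))    ≋⟨ ⊕-cong (lin-cong φW (⋆-congʳ (φ q) (θ⋆-φ c p)))
                                                          (lin-cong φW (⋆-congˡ (φ p) (θ⋆-φ c q))) ⟩
  φ (φ (θ̃ c p) ⋆ φ q) ⊕ φ (φ p ⋆ φ (θ̃ c q))      ∎
  where open ≋-Reasoning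

◇-linearʳ : ∀ p → Linear (p ◇_)
◇-linearʳ p = ∘-linear φ-linear (∘-linear (⋆ʳ-linear (φ p)) φ-linear)

◇-y : ∀ p → p ◇ y ≋ p ⊗ y ⊕ ∂₁ p
◇-y p = begin
  φ (φ p ⋆ φ y)                                   ≋⟨ lin-cong φW (≋-trans (⋆-congˡ (φ p) φ-y) (linear-· (⋆ʳ-linear (φ p)) (- 1ℚ) y)) ⟩
  φ ((- 1ℚ) · (φ p ⋆ y))                          ≋⟨ ≋-trans (linear-· φ-linear (- 1ℚ) (φ p ⋆ y)) (·-cong (- 1ℚ) (φ-⋆y (φ p))) ⟩
  (- 1ℚ) · ((- 1ℚ) · (φ (φ p) ⊗ y) ⊖ φ (δ (φ p)))  ≋⟨ ·-cong (- 1ℚ) (⊖-cong (·-cong (- 1ℚ) (⊗-congʳ y (φ-involutive p))) φδφ) ⟩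
  (- 1ℚ) · ((- 1ℚ) · (p ⊗ y) ⊖ ∂₁ p)              ≋⟨ solve 2 (λ a b → (- 1ℚ) ⊡ ((- 1ℚ) ⊡ a ⊟ b) ⊜ a ⊞ b) refl (p ⊗ y) (∂₁ p) ⟩
  p ⊗ y ⊕ ∂₁ p                                    ∎
  where
  open ≋-Reasoning
  φδφ : φ (δ (φ p)) ≋ ∂₁ p
  φδφ = ≋-trans (≋-sym (∂₁-φ (φ p))) (linear-cong ∂₁-linear (φ-involutive p))

∂₁-⊗x : ∀ p → ∂₁ (p ⊗ x) ≋ (p ◇ y) ⊗ x
∂₁-⊗x p = begin
  ∂₁ (p ⊗ x)                      ≋⟨ ∂₁-⊗ p x ⟩
  ∂₁ p ⊗ x ⊕ p ⊗ ∂₁ x             ≋⟨ ⊕-congˡ (∂₁ p ⊗ x) (≋-trans (⊗-congˡ p ∂₁-x) (≋-sym (⊗-assoc p y x))) ⟩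
  ∂₁ p ⊗ x ⊕ (p ⊗ y) ⊗ x          ≋⟨ solve 2 (λ a b → a ⊞ b ⊜ b ⊞ a) refl (∂₁ p ⊗ x) ((p ⊗ y) ⊗ x) ⟩
  (p ⊗ y) ⊗ x ⊕ ∂₁ p ⊗ x          ≋⟨ ⊗-distribʳ-⊕ (p ⊗ y) (∂₁ p) x ⟨
  (p ⊗ y ⊕ ∂₁ p) ⊗ x              ≋⟨ ⊗-congʳ x (◇-y p) ⟨
  (p ◇ y) ⊗ x                     ∎
  where open ≋-Reasoning

D : ℚ → ℕ → Poly → Poly
D c k = iter k (ad (θ c)) ∂₁

Q : ℚ → ℕ → Poly
Q c k = iter k (θ̃ c) y

D-linear : ∀ c k → Linear (D c k)
D-linear c zero = ∂₁-linear
D-linear c (suc k) = ⊖-linear (∘-linear (θ-linear c) (D-linear c k)) (∘-linear (D-linear c k) (θ-linear c))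

D-⊗z : ∀ c k p → D c k (p ⊗ z) ≋ D c k p ⊗ z
D-⊗z c zero p = ≋-trans (∂₁-⊗ p z) (≋-trans (⊕-congˡ (∂₁ p ⊗ z) (⊗-zeroʳ p ∂₁-z)) (⊕-identityʳ (∂₁ p ⊗ z)))
D-⊗z c (suc k) p = begin
  θ c (D c k (p ⊗ z)) ⊖ D c k (θ c (p ⊗ z))
    ≋⟨ ⊖-cong (≋-trans (linear-cong (θ-linear c) (D-⊗z c k p)) (θ-⊗z c (D c k p)))
              (≋-trans (linear-cong (D-linear c k) (θ-⊗z c p))
                (≋-trans (linear-⊕ (D-linear c k) (θ c p ⊗ z) ((p ⊗ z) ⊗ z))
                  (⊕-cong (D-⊗z c k (θ c p)) (≋-trans (D-⊗z c k (p ⊗ z)) (⊗-congʳ z (D-⊗z c k p)))))) ⟩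
  θ c (D c k p) ⊗ z ⊕ (D c k p ⊗ z) ⊗ z ⊖ (D c k (θ c p) ⊗ z ⊕ (D c k p ⊗ z) ⊗ z)
    ≋⟨ solve 3 (λ a b d → a ⊞ b ⊟ (d ⊞ b) ⊜ a ⊟ d) refl (θ c (D c k p) ⊗ z) ((D c k p ⊗ z) ⊗ z) (D c k (θ c p) ⊗ z) ⟩
  θ c (D c k p) ⊗ z ⊖ D c k (θ c p) ⊗ z
    ≋⟨ ⊗-distribʳ-⊖ (θ c (D c k p)) (D c k (θ c p)) z ⟨
  (θ c (D c k p) ⊖ D c k (θ c p)) ⊗ z ∎
  where open ≋-Reasoning

D-⊗x : ∀ c k p → D c k (p ⊗ x) ≋ (p ◇ Q c k) ⊗ x
D-⊗x c zero p = ∂₁-⊗x p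
D-⊗x c (suc k) p = begin
  θ c (D c k (p ⊗ x)) ⊖ D c k (θ c (p ⊗ x))
    ≋⟨ ⊖-cong (≋-trans (linear-cong (θ-linear c) (D-⊗x c k p)) (θ-⊗x c (p ◇ Q c k)))
              (≋-trans (linear-cong (D-linear c k) (θ-⊗x c p))
                (≋-trans (linear-⊕ (D-linear c k) (θ̃ c p ⊗ x) ((p ⊗ x) ⊗ z))
                  (⊕-cong (D-⊗x c k (θ̃ c p)) (≋-trans (D-⊗z c k (p ⊗ x)) (⊗-congʳ z (D-⊗x c k p)))))) ⟩
  θ̃ c (p ◇ Q c k) ⊗ x ⊕ ((p ◇ Q c k) ⊗ x) ⊗ z ⊖ ((θ̃ c p ◇ Q c k) ⊗ x ⊕ ((p ◇ Q c k) ⊗ x) ⊗ z)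
    ≋⟨ solve 3 (λ a b d → a ⊞ b ⊟ (d ⊞ b) ⊜ a ⊟ d) refl
         (θ̃ c (p ◇ Q c k) ⊗ x) (((p ◇ Q c k) ⊗ x) ⊗ z) ((θ̃ c p ◇ Q c k) ⊗ x) ⟩
  θ̃ c (p ◇ Q c k) ⊗ x ⊖ (θ̃ c p ◇ Q c k) ⊗ x
    ≋⟨ ⊗-distribʳ-⊖ (θ̃ c (p ◇ Q c k)) (θ̃ c p ◇ Q c k) x ⟨
  (θ̃ c (p ◇ Q c k) ⊖ θ̃ c p ◇ Q c k) ⊗ x
    ≋⟨ ⊗-congʳ x (≋-trans (⊖-cong (θ̃-◇ c p (Q c k)) ≋-refl)
         (solve 2 (λ a b → a ⊞ b ⊟ a ⊜ b) refl (θ̃ c p ◇ Q c k) (p ◇ θ̃ c (Q c k)))) ⟩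
  (p ◇ Q c (suc k)) ⊗ x ∎
  where open ≋-Reasoning

theorem2p2 : (n : ℕ) → 1 ≤ n → (c : ℚ) → (w : Poly) →
    ∂ c n (w ⊗ x) ≈ (w ◇ q c n) ⊗ x
theorem2p2 n _ c w = ≋⇒≈ (begin
  invFact (n ∸ 1) · D c (n ∸ 1) (w ⊗ x)           ≋⟨ ·-cong (invFact (n ∸ 1)) (D-⊗x c (n ∸ 1) w) ⟩
  invFact (n ∸ 1) · ((w ◇ Q c (n ∸ 1)) ⊗ x)       ≋⟨ ·-⊗ (invFact (n ∸ 1)) (w ◇ Q c (n ∸ 1)) x ⟨
  (invFact (n ∸ 1) · (w ◇ Q c (n ∸ 1))) ⊗ x       ≋⟨ ⊗-congʳ x (linear-· (◇-linearʳ w) (invFact (n ∸ 1)) (Q c (n ∸ 1))) ⟨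
  (w ◇ q c n) ⊗ x                                 ∎)
  where open ≋-Reasoning
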